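{- Let $\mathcal{P}$ be a regular $n$-polytope with simple Petrie polygons, and suppose $\mathcal{P}$ is non-degenerate and not self-dual. Let $\Gamma=\Gamma(\mathcal{P})=\langle\rho_0,\dots,\rho_{n-1}\rangle$ with distinguished generators $\rho_i$. Let $\mathcal{X}$ be the family-1 premaniplex with $n$ sides, with 1-faces $e_0,\dots,e_{n-1}$, and let $\xi$ be the voltage assignment on $\mathcal{X}$ giving trivial voltage to all darts of colors 0 and 1 and voltage $\rho_i$ to each dart of color 2 whose initial flag lies in $e_i$. Then the derived graph $\mathcal{X}^\xi$ is a polyhedron (abstract 3-polytope) whose symmetry type graph is isomorphic to $\mathcal{X}$. In particular $\mathcal{X}^\xi$ is vertex-transitive, facet-transitive and has trivial facet stabilizer.
   Context: Graphs may have semi-edges and parallel edges: a graph has vertices, darts, an initial-vertex map $I$ and an involution $d\mapsto d^{ -1}$ on darts; $T(d)=I(d^{ -1})$. An $n$-premaniplex is a connected graph with edges colored by $\{0,\dots,n-1\}$ such that every vertex (flag) is incident to exactly one edge of each color and for $|i-j|>1$ alternating paths of length 4 in colors $i,j$ are closed; an $n$-maniplex is a simple $n$-premaniplex. $r_i\Phi$ is the flag joined to $\Phi$ by its edge of color $i$. The $i$-faces are the connected components after deleting the color-$i$ edges ($0$-faces: vertices; $(n-1)$-faces: facets). Automorphisms are color-preserving graph automorphisms, acting on the right; $\Gamma(\mathcal{M})$ is the automorphism group. An abstract $n$-polytope is an $n$-maniplex such that whenever two flags are joined by a path with colors in $[0,m]$ and by one with colors in $[k,n-1]$, they are joined by a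 path with colors in $[k,m]$; a polyhedron is a 3-polytope. $\mathcal{P}$ is regular if $\Gamma(\mathcal{P})$ is transitive on flags; fixing a base flag $\Phi$, $\rho_i$ is the automorphism with $\Phi\rho_i=r_i\Phi$. $\mathcal{P}$ is non-degenerate if no $(r_ir_{i+1})^2$ fixes a flag. The dual of $\mathcal{P}$ recolors each color $i$ as $n-1-i$; $\mathcal{P}$ is self-dual if isomorphic to its dual. A Petrie polygon is an orbit of flags under $r_{n-1}\cdots r_1r_0$; it is simple if distinct flags in it lie in distinct vertices. Family-1 premaniplex with $n$ sides: start from an $n$-gon (a 2-premaniplex whose $2n$ flags form a cycle alternating colors 0,1), fix a flag $y_0$, let $e_i$ ($0\le i\le n-1$) be the 1-face $\{(r_1r_0)^iy_0,\ r_0(r_1r_0)^iy_0\}$, and add for each $i$ an edge of color 2 joining the two flags of $e_i$. A voltage assignment on a graph $\mathcal{X}$ with group $\Gamma$ is a map $\xi$ from darts to $\Gamma$ with $\xi(d^{ -1})=\xi(d)^{ -1}$. The derived graph $\mathcal{X}^\xi$ has vertex set $V(\mathcal{X})\times\Gamma$ and dart set $D(\mathcal{X})\times\Gamma$, where the dart $(d,\gamma)$ goes from $(I(d),\gamma)$ to $(T(d),\xi(d)\gamma)$, with $(d,\gamma)^{ -1}=(d^{ -1},\xi(d)\gamma)$, and colors inherited from $\mathcal{X}$. The symmetry type graph of a maniplex is the quotient by its automorphism group: vertices are flag orbits, with an edge of color $i$ between the orbits of $\Phi$ and $r_i\Phi$ (a semi-edge if equal). Vertex-/facet-transitive means $\Gamma$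 transitive on vertices/facets; trivial facet stabilizer means only the identity maps a facet to itself. -}

module Defs where

open import Data.Nat using (ℕ; zero; suc; _≤_; _<_; _+_)
open import Data.Nat.Properties using (<⇒≤)
open import Data.Nat.DivMod using (_mod_)
open import Data.Fin using (Fin; zero; suc; toℕ; fromℕ; fromℕ<; opposite)
open import Data.Bool using (Bool; true; false; not)
open import Data.Product using (Σ; _×_; _,_; ∃)
open import Data.Sum using (_⊎_)
open import Data.List using (List; []; _∷_; allFin)
open import Data.List.Relation.Unary.All using (All)
open import Relation.Binary.PropositionalEquality using (_≡_; _≢_)
open import Relation.Nullary using (¬_)
open import Algebra.Structures using (IsGroup)

-- An n-edge-coloured graph in which every vertex (flag) has exactly one
-- edge of each colour is given by its flag set and the maps r_i
-- (r_i Φ = the flag joined to Φ by its edge of colour i; a semi-edge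
-- when r_i Φ ≡ Φ).  That r_i is an involution is part of IsPremaniplex.

record ColoredGraph (n : ℕ) : Set₁ where
  field
    Flag : Set
    r    : Fin n → Flag → Flag
open ColoredGraph public

module _ {n : ℕ} (M : ColoredGraph n) where

  applyW : List (Fin n) → Flag M → Flag M
  applyW []      Φ = Φ
  applyW (c ∷ w) Φ = applyW w (r M c Φ)

  PathIn : (Fin n → Set) → Flag M → Flag M → Set
  PathIn P Φ Ψ = Σ (List (Fin n)) λ w → All P w × applyW w Φ ≡ Ψ

  Connected : Set
  Connected = ∀ Φ Ψ → Σ (List (Fin n)) λ w → applyW w Φ ≡ Ψ

  record IsPremaniplex : Set where
    field
      inhabited : Flag M
      involutive : ∀ i Φ → r M i (r M i Φ) ≡ Φ
      connected : Connected
      commuting : ∀ (i j : Fin n) → (toℕ i + 2 ≤ toℕ j ⊎ toℕ j + 2 ≤ toℕ i) → ∀ Φ →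
                  r M i (r M j (r M i (r M j Φ))) ≡ Φ

  record IsManiplex : Set where
    field
      premaniplex : IsPremaniplex
      noSemiEdges : ∀ i Φ → r M i Φ ≢ Φ
      noParallel  : ∀ i j Φ → r M i Φ ≡ r M j Φ → i ≡ j

  -- diamond/strong flag connectivity condition of abstract polytopes
  PolytopeCondition : Set
  PolytopeCondition = ∀ (k m : Fin n) Φ Ψ →
    PathIn (λ c → toℕ c ≤ toℕ m) Φ Ψ →
    PathIn (λ c → toℕ k ≤ toℕ c) Φ Ψ →
    PathIn (λ c → toℕ k ≤ toℕ c × toℕ c ≤ toℕ m) Φ Ψ

  record IsPolytope : Set where
    field
      maniplex : IsManiplex
      polytope : PolytopeCondition

  SameFace : Fin n → Flag M → Flag M → Set
  SameFace i = PathIn (λ c → c ≢ i)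

  record Aut : Set where
    field
      f     : Flag M → Flag M
      f⁻    : Flag M → Flag M
      f-f⁻  : ∀ Φ → f (f⁻ Φ) ≡ Φ
      f⁻-f  : ∀ Φ → f⁻ (f Φ) ≡ Φ
      f-r   : ∀ i Φ → f (r M i Φ) ≡ r M i (f Φ)

  IsRegular : Set
  IsRegular = ∀ Φ Ψ → Σ Aut λ α → Aut.f α Φ ≡ Ψ

  petrie : Flag M → Flag M
  petrie = applyW (allFin n)

  petrieⁿ : ℕ → Flag M → Flag M
  petrieⁿ zero    Φ = Φ
  petrieⁿ (suc k) Φ = petrie (petrieⁿ k Φ)

  InPetrie : Flag M → Flag M → Set
  InPetrie Φ Ψ = Σ ℕ λ k → petrieⁿ k Φ ≡ Ψ ⊎ petrieⁿ k Ψ ≡ Φ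

  SimplePetrie : Set
  SimplePetrie = ∀ (v : Fin n) → toℕ v ≡ 0 → ∀ Φ Ψ₁ Ψ₂ →
                 InPetrie Φ Ψ₁ → InPetrie Φ Ψ₂ → Ψ₁ ≢ Ψ₂ → ¬ SameFace v Ψ₁ Ψ₂

  NonDegenerate : Set
  NonDegenerate = ∀ (i : ℕ) (h : suc i < n) Φ →
    r M (fromℕ< (<⇒≤ h)) (r M (fromℕ< h) (r M (fromℕ< (<⇒≤ h)) (r M (fromℕ< h) Φ))) ≢ Φ

  dual : ColoredGraph n
  dual = record { Flag = Flag M ; r = λ i → r M (opposite i) }

  -- the automorphism group Γ(M), presented as an abstract group G
  -- (with propositional equality) acting faithfully on the right on the
  -- flags by automorphisms, such that every automorphism is realised.
  record AutGroup : Set₁ where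
    field
      G        : Set
      _∙_      : G → G → G
      ε        : G
      _⁻¹      : G → G
      isGroup  : IsGroup _≡_ _∙_ ε _⁻¹
      act      : Flag M → G → Flag M
      act-ε    : ∀ Φ → act Φ ε ≡ Φ
      act-∙    : ∀ Φ g h → act Φ (g ∙ h) ≡ act (act Φ g) h
      act-r    : ∀ g i Φ → act (r M i Φ) g ≡ r M i (act Φ g)
      faithful : ∀ g h → (∀ Φ → act Φ g ≡ act Φ h) → g ≡ h
      complete : (α : Aut) → Σ G λ g → ∀ Φ → Aut.f α Φ ≡ act Φ g

record Iso {n : ℕ} (M N : ColoredGraph n) : Set where
  field
    f    : Flag M → Flag N
    f⁻   : Flag N → Flag M
    f-f⁻ : ∀ Φ → f (f⁻ Φ) ≡ Φ
    f⁻-f : ∀ Φ → f⁻ (f Φ) ≡ Φ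
    f-r  : ∀ i Φ → f (r M i Φ) ≡ r N i (f Φ)

SelfDual : {n : ℕ} → ColoredGraph n → Set
SelfDual M = Iso M (dual M)

-- The symmetry type graph of M (flags modulo Γ(M), with r_i[Φ] = [r_i Φ])
-- is isomorphic to X: there is a map q from flags of M onto flags of X,
-- whose fibres are exactly the Γ(M)-orbits, commuting with every r_i.
-- (q = the isomorphism composed with the projection onto the quotient.)
record SymTypeGraphIso {n : ℕ} (M X : ColoredGraph n) : Set where
  field
    q       : Flag M → Flag X
    q-surj  : ∀ x → Σ (Flag M) λ Φ → q Φ ≡ x
    q-orbit : ∀ Φ Ψ → q Φ ≡ q Ψ → Σ (Aut M) λ α → Aut.f α Φ ≡ Ψ
    orbit-q : ∀ (α : Aut M) Φ → q (Aut.f α Φ) ≡ q Φ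
    q-r     : ∀ i Φ → q (r M i Φ) ≡ r X i (q Φ)

module _ {k : ℕ} (M : ColoredGraph (suc k)) where

  VertexTransitive : Set
  VertexTransitive = ∀ Φ Ψ → Σ (Aut M) λ α → SameFace M zero (Aut.f α Φ) Ψ

  FacetTransitive : Set
  FacetTransitive = ∀ Φ Ψ → Σ (Aut M) λ α → SameFace M (fromℕ k) (Aut.f α Φ) Ψ

  TrivialFacetStabilizer : Set
  TrivialFacetStabilizer = ∀ (α : Aut M) Φ →
    SameFace M (fromℕ k) Φ (Aut.f α Φ) → ∀ Ψ → Aut.f α Ψ ≡ Ψ

nextF : ∀ {n} → Fin n → Fin n
nextF {suc m} i = (suc (toℕ i)) mod (suc m)

prevF : ∀ {n} → Fin n → Fin n
prevF {suc m} i = (toℕ i + m) mod (suc m)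

-- The flags of the n-gon are
-- (i , false) = (r1 r0)^i y0  and  (i , true) = r0 (r1 r0)^i y0, so
-- e_i = {(i,false),(i,true)}; the colour-2 edge joins the two flags of e_i.
family1 : (n : ℕ) → ColoredGraph 3
family1 n = record { Flag = Fin n × Bool ; r = rr }
  where
    rr : Fin 3 → Fin n × Bool → Fin n × Bool
    rr zero (i , b) = (i , not b)
    rr (suc zero) (i , false) = (prevF i , true)
    rr (suc zero) (i , true)  = (nextF i , false)
    rr (suc (suc zero)) (i , b) = (i , not b)

-- Derived graph of X with voltage ξ (ξ c x = voltage of the dart of colour c
-- with initial flag x) in the group (G, _∙_): the dart (d,γ) goes from
-- (I d , γ) to (T d , ξ(d) γ).
derived : {m : ℕ} (X : ColoredGraph m) {G : Set} (_∙_ : G → G → G) →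
          (Fin m → Flag X → G) → ColoredGraph m
derived X {G} _∙_ ξ = record
  { Flag = Flag X × G
  ; r = λ c → λ { (x , γ) → (r X c x , (ξ c x ∙ γ)) } }

voltage1 : {n : ℕ} {G : Set} (ε : G) (ρ : Fin n → G) → Fin 3 → Fin n × Bool → G
voltage1 ε ρ zero _ = ε
voltage1 ε ρ (suc zero) _ = ε
voltage1 ε ρ (suc (suc zero)) (i , _) = ρ i

-- Through the flag action g ↦ Φ₀ g, a flag (x , g) of the derived graph D is a label x of X together
-- with a flag of P, and a colour-2 edge at the 1-face e_i acts on the second coordinate as r_i. Walks of
-- colours 1, 2 around a vertex of D thus trace segments of Petrie polygons of P; since these are simple,
-- such a walk can only return with the same group element after whole Petrie periods, which gives the
-- polytope condition. Right multiplications by Γ are automorphisms of D, transitive on each set of flags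
-- with a common label. Conversely, an automorphism must map the base label to a label at which
-- (r₁ r₂ r₀)⁴ fixes a flag; by non-degeneracy this is the base label itself or its mirror image, and the
-- mirror image would make P self-dual. In rank at most 2 there is nothing to prove, polygons being self-dual.

module Submission where

open import Defs
open import Algebra.Structures using (IsGroup)
open import Data.Nat using (ℕ; zero; suc; _+_; _*_; _∸_; _≤_; _<_; z≤n; s≤s; _%_; _/_; _<?_)
open import Data.Nat.Properties
  using (_≟_; +-comm; +-assoc; +-suc; +-identityʳ; +-cancelˡ-≡; +-∸-assoc; *-suc; *-commutativeSemigroup;
         ≤-refl; ≤-reflexive; ≤-trans; ≤-pred; <-≤-trans; ≤-<-trans; <⇒≤; ≤∧≢⇒<; <-cmp; 1+n≢n; 1+n≰n;
         m≤m+n; m<m+n; m≤n⇒m≤1+n; m+[n∸m]≡n; m∸n≤m; n∸n≡0)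
open import Data.Nat.DivMod using (_mod_; %-distribˡ-+; [m+kn]%n≡m%n; [m+n]%n≡m%n; m%n%n≡m%n; m%n<n; m<n⇒m%n≡m; m≡m%n+[m/n]*n; n%n≡0)
open import Data.Nat.Divisibility using (_∣_; _∣?_; divides)
open import Algebra.Properties.CommutativeSemigroup *-commutativeSemigroup using (xy∙z≈xz∙y)
open import Data.Bool using (Bool; true; false; not)
open import Data.Bool.Properties using (not-involutive; not-¬) renaming (_≟_ to _≟ᵇ_)
open import Data.Fin using (Fin; zero; suc; toℕ; fromℕ<; opposite)
open import Data.Fin.Properties using (toℕ-injective; toℕ-fromℕ<; toℕ<n; opposite-prop; opposite-involutive) renaming (_≟_ to _≟ᶠ_)
open import Data.Product using (Σ; _×_; _,_; proj₁; proj₂)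
open import Data.Product.Properties using (≡-dec)
open import Data.Sum using (_⊎_; inj₁; inj₂; [_,_])
open import Data.Empty using (⊥-elim)
open import Data.List using (List; []; _∷_; _++_; _∷ʳ_; reverse; map; tabulate)
open import Data.List.Properties using (unfold-reverse; reverse-involutive; reverse-map; map-++; map-∘; map-id; map-cong)
open import Data.List.Relation.Unary.All as All using (All; []; _∷_)
open import Data.List.Relation.Unary.All.Properties using (++⁺; map⁺)
open import Function using (id; _∘_)
open import Relation.Binary using (tri<; tri≈; tri>)
open import Relation.Binary.Definitions using (DecidableEquality)
open import Relation.Binary.PropositionalEquality hiding ([_])
open import Relation.Nullary using (¬_; yes; no)
open import Relation.Nullary.Decidable using (decidable-stable)
open import Relation.Nullary.Negation using (contradiction; ¬¬-map)

All-reverse : {A : Set} {P : A → Set} {xs : List A} → All P xs → All P (reverse xs)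
All-reverse {xs = []} [] = []
All-reverse {xs = x ∷ xs} (p ∷ ps) rewrite unfold-reverse x xs = ++⁺ (All-reverse ps) (p ∷ [])

module Walk {n : ℕ} (M : ColoredGraph n) where

  applyW-++ : ∀ v w Φ → applyW M (v ++ w) Φ ≡ applyW M w (applyW M v Φ)
  applyW-++ []      w Φ = refl
  applyW-++ (c ∷ v) w Φ = applyW-++ v w (r M c Φ)

  applyW-∷ʳ : ∀ w c Φ → applyW M (w ∷ʳ c) Φ ≡ r M c (applyW M w Φ)
  applyW-∷ʳ w c Φ = applyW-++ w (c ∷ []) Φ

  PathIn-trans : ∀ {P : Fin n → Set} {Φ Ψ Θ} → PathIn M P Φ Ψ → PathIn M P Ψ Θ → PathIn M P Φ Θ
  PathIn-trans {Φ = Φ} (v , pv , refl) (w , pw , refl) = v ++ w , ++⁺ pv pw , applyW-++ v w Φ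

  PathIn-map : ∀ {Q R : Fin n → Set} {Φ Ψ} → (∀ {d} → Q d → R d) → PathIn M Q Φ Ψ → PathIn M R Φ Ψ
  PathIn-map f (w , qs , e) = w , All.map f qs , e

  Aut-applyW : (α : Aut M) → ∀ w Φ → Aut.f α (applyW M w Φ) ≡ applyW M w (Aut.f α Φ)
  Aut-applyW α []      Φ = refl
  Aut-applyW α (c ∷ w) Φ = trans (Aut-applyW α w (r M c Φ)) (cong (applyW M w) (Aut.f-r α c Φ))

  connected-elim : Connected M → (Q : Flag M → Set) → (∀ c Φ → Q Φ → Q (r M c Φ)) → ∀ {Φ} → Q Φ → ∀ Ψ → Q Ψ
  connected-elim connected Q step {Φ} qΦ Ψ with connected Φ Ψ
  ... | w , refl = go w qΦ
    where
      go : ∀ w {Θ} → Q Θ → Q (applyW M w Θ)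
      go []      q = q
      go (c ∷ w) q = go w (step c _ q)

  Aut-fixes-all : Connected M → (α : Aut M) → ∀ {Φ} → Aut.f α Φ ≡ Φ → ∀ Ψ → Aut.f α Ψ ≡ Ψ
  Aut-fixes-all connected α = connected-elim connected (λ Ψ → Aut.f α Ψ ≡ Ψ) (λ c Ψ fixed → trans (Aut.f-r α c Ψ) (cong (r M c) fixed))

  module Reversible (involutive : ∀ i Φ → r M i (r M i Φ) ≡ Φ) where

    applyW-reverse-applyW : ∀ w Φ → applyW M (reverse w) (applyW M w Φ) ≡ Φ
    applyW-reverse-applyW []      Φ = refl
    applyW-reverse-applyW (c ∷ w) Φ = begin
      applyW M (reverse (c ∷ w)) (applyW M w (r M c Φ))   ≡⟨ cong (λ v → applyW M v (applyW M w (r M c Φ))) (unfold-reverse c w) ⟩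
      applyW M (reverse w ∷ʳ c) (applyW M w (r M c Φ))    ≡⟨ applyW-∷ʳ (reverse w) c _ ⟩
      r M c (applyW M (reverse w) (applyW M w (r M c Φ))) ≡⟨ cong (r M c) (applyW-reverse-applyW w (r M c Φ)) ⟩
      r M c (r M c Φ)                                     ≡⟨ involutive c Φ ⟩
      Φ                                                   ∎
      where open ≡-Reasoning

    applyW-applyW-reverse : ∀ w Φ → applyW M w (applyW M (reverse w) Φ) ≡ Φ
    applyW-applyW-reverse []      Φ = refl
    applyW-applyW-reverse (c ∷ w) Φ = begin
      applyW M w (r M c (applyW M (reverse (c ∷ w)) Φ))   ≡⟨ cong (λ v → applyW M w (r M c (applyW M v Φ))) (unfold-reverse c w) ⟩
      applyW M w (r M c (applyW M (reverse w ∷ʳ c) Φ))    ≡⟨ cong (λ Ψ → applyW M w (r M c Ψ)) (applyW-∷ʳ (reverse w) c Φ) ⟩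
      applyW M w (r M c (r M c (applyW M (reverse w) Φ))) ≡⟨ cong (applyW M w) (involutive c _) ⟩
      applyW M w (applyW M (reverse w) Φ)                 ≡⟨ applyW-applyW-reverse w Φ ⟩
      Φ                                                   ∎
      where open ≡-Reasoning

    applyW-injective : ∀ w {Φ Ψ} → applyW M w Φ ≡ applyW M w Ψ → Φ ≡ Ψ
    applyW-injective w {Φ} {Ψ} e = begin
      Φ                                   ≡⟨ applyW-reverse-applyW w Φ ⟨
      applyW M (reverse w) (applyW M w Φ) ≡⟨ cong (applyW M (reverse w)) e ⟩
      applyW M (reverse w) (applyW M w Ψ) ≡⟨ applyW-reverse-applyW w Ψ ⟩
      Ψ                                   ∎
      where open ≡-Reasoning

    commuting-square : ∀ i j → (∀ Φ → r M i (r M j Φ) ≡ r M j (r M i Φ)) → ∀ Φ → r M i (r M j (r M i (r M j Φ))) ≡ Φ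
    commuting-square i j commute Φ = trans (cong (r M i ∘ r M j) (commute Φ)) (trans (cong (r M i) (involutive j _)) (involutive i Φ))

    reverse-closed : ∀ w Φ → applyW M w Φ ≡ Φ → applyW M (reverse w) Φ ≡ Φ
    reverse-closed w Φ closed = trans (cong (applyW M (reverse w)) (sym closed)) (applyW-reverse-applyW w Φ)

    PathIn-sym : ∀ {P : Fin n → Set} {Φ Ψ} → PathIn M P Φ Ψ → PathIn M P Ψ Φ
    PathIn-sym {Φ = Φ} (w , pw , refl) = reverse w , All-reverse pw , applyW-reverse-applyW w Φ

module AutGroupFacts {n : ℕ} {M : ColoredGraph n} (Γ : AutGroup M) where
  open AutGroup Γ
  open Walk M

  act-injective : Connected M → ∀ Φ {g h} → act Φ g ≡ act Φ h → g ≡ h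
  act-injective connected Φ {g} {h} e = faithful g h λ Ψ → connected-elim connected (λ Θ → act Θ g ≡ act Θ h)
    (λ c Θ e′ → trans (act-r g c Θ) (trans (cong (r M c) e′) (sym (act-r h c Θ)))) e Ψ

  act-surjective : IsRegular M → ∀ Φ Ψ → Σ G λ g → act Φ g ≡ Ψ
  act-surjective regular Φ Ψ with regular Φ Ψ
  ... | α , αΦ≡Ψ with complete α
  ...   | g , α≗g = g , trans (sym (α≗g Φ)) αΦ≡Ψ

derived-applyW-proj₁ : ∀ {m} (X : ColoredGraph m) {G : Set} (_∙_ : G → G → G) (ξ : Fin m → Flag X → G) →
                       ∀ w Φ → proj₁ (applyW (derived X _∙_ ξ) w Φ) ≡ applyW X w (proj₁ Φ)
derived-applyW-proj₁ X _∙_ ξ []      Φ = refl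
derived-applyW-proj₁ X _∙_ ξ (c ∷ w) Φ = derived-applyW-proj₁ X _∙_ ξ w (r (derived X _∙_ ξ) c Φ)

module Cyclic (m : ℕ) where

  n : ℕ
  n = suc m

  colour : ℕ → Fin n
  colour a = a mod n

  toℕ-colour : ∀ a → toℕ (colour a) ≡ a % n
  toℕ-colour a = toℕ-fromℕ< _

  colour-cong : ∀ {a} {b} → a % n ≡ b % n → colour a ≡ colour b
  colour-cong {a} {b} e = toℕ-injective (trans (toℕ-colour a) (trans e (sym (toℕ-colour b))))

  toℕ-colour-< : ∀ {a} → a < n → toℕ (colour a) ≡ a
  toℕ-colour-< {a} a<n = trans (toℕ-colour a) (m<n⇒m%n≡m a<n)

  colour-toℕ : ∀ (i : Fin n) → colour (toℕ i) ≡ i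
  colour-toℕ i = toℕ-injective (toℕ-colour-< (toℕ<n i))

  colour-+* : ∀ a q → colour (a + q * n) ≡ colour a
  colour-+* a q = colour-cong {a + q * n} {a} ([m+kn]%n≡m%n a q n)

  colour-*+ : ∀ q a → colour (q * n + a) ≡ colour a
  colour-*+ q a = trans (cong colour (+-comm (q * n) a)) (colour-+* a q)

  complete-period : ∀ q {a} → a ≤ n → q * n + a + (n ∸ a) ≡ suc q * n
  complete-period q {a} a≤n = trans (+-assoc (q * n) a (n ∸ a)) (trans (cong (q * n +_) (m+[n∸m]≡n a≤n)) (+-comm (q * n) n))

  colour-+n : ∀ a → colour (a + n) ≡ colour a
  colour-+n a = colour-cong {a + n} {a} ([m+n]%n≡m%n a n)

  colour-+-modʳ : ∀ a b → colour (a + toℕ (colour b)) ≡ colour (a + b)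
  colour-+-modʳ a b = colour-cong {a + toℕ (colour b)} {a + b} (begin
    (a + toℕ (colour b)) % n ≡⟨ cong (λ z → (a + z) % n) (toℕ-colour b) ⟩
    (a + b % n) % n          ≡⟨ %-distribˡ-+ a (b % n) n ⟩
    (a % n + b % n % n) % n  ≡⟨ cong (λ z → (a % n + z) % n) (m%n%n≡m%n b n) ⟩
    (a % n + b % n) % n      ≡⟨ %-distribˡ-+ a b n ⟨
    (a + b) % n              ∎)
    where open ≡-Reasoning

  colour-+-modˡ : ∀ a b → colour (toℕ (colour a) + b) ≡ colour (a + b)
  colour-+-modˡ a b = trans (cong colour (+-comm (toℕ (colour a)) b)) (trans (colour-+-modʳ b a) (cong colour (+-comm b a)))

  nextF-colour : ∀ a → nextF (colour a) ≡ colour (suc a)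
  nextF-colour = colour-+-modʳ 1

  prevF-colour : ∀ a → prevF (colour (suc a)) ≡ colour a
  prevF-colour a = begin
    colour (toℕ (colour (suc a)) + m) ≡⟨ cong colour (+-comm _ m) ⟩
    colour (m + toℕ (colour (suc a))) ≡⟨ colour-+-modʳ m (suc a) ⟩
    colour (m + suc a)                ≡⟨ cong colour (trans (+-suc m a) (+-comm n a)) ⟩
    colour (a + n)                    ≡⟨ colour-+n a ⟩
    colour a                          ∎
    where open ≡-Reasoning

  nextF-prevF : ∀ (i : Fin n) → nextF (prevF i) ≡ i
  nextF-prevF i = begin
    nextF (colour (toℕ i + m)) ≡⟨ nextF-colour (toℕ i + m) ⟩
    colour (suc (toℕ i + m))   ≡⟨ cong colour (+-suc (toℕ i) m) ⟨
    colour (toℕ i + n)         ≡⟨ colour-+n (toℕ i) ⟩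
    colour (toℕ i)             ≡⟨ colour-toℕ i ⟩
    i                          ∎
    where open ≡-Reasoning

  prevF-nextF : ∀ (i : Fin n) → prevF (nextF i) ≡ i
  prevF-nextF i = trans (prevF-colour (toℕ i)) (colour-toℕ i)

  nextF-injective : ∀ {i j : Fin n} → nextF i ≡ nextF j → i ≡ j
  nextF-injective {i} {j} e = trans (sym (prevF-nextF i)) (trans (cong prevF e) (prevF-nextF j))

  toℕ-prevF-suc : ∀ (i : Fin m) → toℕ (prevF (suc i)) ≡ toℕ i
  toℕ-prevF-suc i = begin
    toℕ (prevF (suc i))                ≡⟨ cong (λ j → toℕ (prevF j)) (colour-toℕ (suc i)) ⟨
    toℕ (prevF (colour (suc (toℕ i)))) ≡⟨ cong toℕ (prevF-colour (toℕ i)) ⟩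
    toℕ (colour (toℕ i))               ≡⟨ toℕ-colour-< (m≤n⇒m≤1+n (toℕ<n i)) ⟩
    toℕ i                              ∎
    where open ≡-Reasoning

  toℕ-prevF-zero : toℕ (prevF {n} zero) ≡ m
  toℕ-prevF-zero = toℕ-colour-< ≤-refl

  nextF-opposite : ∀ (i : Fin n) → nextF (opposite i) ≡ opposite (prevF i)
  nextF-opposite i = toℕ-injective (begin
    toℕ (nextF (opposite i))   ≡⟨ toℕ-colour (suc (toℕ (opposite i))) ⟩
    suc (toℕ (opposite i)) % n ≡⟨ cong (λ z → suc z % n) (opposite-prop i) ⟩
    suc (m ∸ toℕ i) % n        ≡⟨ lemma i ⟩
    m ∸ toℕ (prevF i)          ≡⟨ opposite-prop (prevF i) ⟨
    toℕ (opposite (prevF i))   ∎)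
    where
      open ≡-Reasoning
      lemma : ∀ (i : Fin n) → suc (m ∸ toℕ i) % n ≡ m ∸ toℕ (prevF i)
      lemma zero    = begin
        n % n                    ≡⟨ n%n≡0 n ⟩
        0                        ≡⟨ n∸n≡0 m ⟨
        m ∸ m                    ≡⟨ cong (m ∸_) toℕ-prevF-zero ⟨
        m ∸ toℕ (prevF {n} zero) ∎
      lemma (suc j) = begin
        suc (m ∸ suc (toℕ j)) % n ≡⟨ cong (_% n) (+-∸-assoc 1 (toℕ<n j)) ⟨
        (m ∸ toℕ j) % n           ≡⟨ m<n⇒m%n≡m (s≤s (m∸n≤m m (toℕ j))) ⟩
        m ∸ toℕ j                 ≡⟨ cong (m ∸_) (toℕ-prevF-suc j) ⟨
        m ∸ toℕ (prevF (suc j))   ∎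

  prevF-opposite : ∀ (i : Fin n) → prevF (opposite i) ≡ opposite (nextF i)
  prevF-opposite i = nextF-injective (begin
    nextF (prevF (opposite i)) ≡⟨ nextF-prevF (opposite i) ⟩
    opposite i                 ≡⟨ cong opposite (prevF-nextF i) ⟨
    opposite (prevF (nextF i)) ≡⟨ nextF-opposite (nextF i) ⟨
    nextF (opposite (nextF i)) ∎)
    where open ≡-Reasoning

module Polytope {n : ℕ} (P : ColoredGraph n) (polytopeP : IsPolytope P) where
  open IsPolytope polytopeP
  open IsManiplex maniplex
  open Walk P

  private
    absurd-path : ∀ {Q : Fin n → Set} {c Φ} → (∀ {d} → ¬ Q d) → ¬ PathIn P Q (r P c Φ) Φ
    absurd-path {c = c} {Φ} ¬Q ([]    , _      , e) = noSemiEdges c Φ e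
    absurd-path             ¬Q (_ ∷ _ , q ∷ _  , _) = ¬Q q

  -- The polytope condition for the interval [c + 1, c] forces such a path to be empty.
  r-unreachable-above : ∀ c Φ → ¬ PathIn P (λ d → toℕ c < toℕ d) (r P c Φ) Φ
  r-unreachable-above c Φ above with suc (toℕ c) <? n
  ... | yes c+1<n = absurd-path (λ (k≤d , d≤c) → 1+n≰n (≤-trans (subst (_≤ _) (toℕ-fromℕ< c+1<n) k≤d) d≤c))
                      (polytope (fromℕ< c+1<n) c (r P c Φ) Φ below (PathIn-map (subst (_≤ _) (sym (toℕ-fromℕ< c+1<n))) above))
    where
      below : PathIn P (λ d → toℕ d ≤ toℕ c) (r P c Φ) Φ
      below = c ∷ [] , ≤-refl ∷ [] , IsPremaniplex.involutive premaniplex c Φ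
  ... | no c+1≮n = absurd-path (λ {d} c<d → c+1≮n (≤-<-trans c<d (toℕ<n d))) above

module PetrieWalks {m : ℕ} (P : ColoredGraph (suc m)) (polytopeP : IsPolytope P) (simplePetrie : SimplePetrie P) where
  open Cyclic m
  open Walk P
  open Reversible (IsPremaniplex.involutive (IsManiplex.premaniplex (IsPolytope.maniplex polytopeP)))
  open Polytope P polytopeP

  ascent : ℕ → ℕ → List (Fin n)
  ascent a zero    = []
  ascent a (suc t) = colour a ∷ ascent (suc a) t

  climb : ℕ → ℕ → Flag P → Flag P
  climb a t = applyW P (ascent a t)

  ascent-+ : ∀ a s t → ascent a (s + t) ≡ ascent a s ++ ascent (a + s) t
  ascent-+ a zero    t = cong (λ b → ascent b t) (sym (+-identityʳ a))
  ascent-+ a (suc s) t = cong (colour a ∷_) (trans (ascent-+ (suc a) s t) (cong (λ b → ascent (suc a) s ++ ascent b t) (sym (+-suc a s))))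

  climb-+ : ∀ a s t Θ → climb a (s + t) Θ ≡ climb (a + s) t (climb a s Θ)
  climb-+ a s t Θ = trans (cong (λ w → applyW P w Θ) (ascent-+ a s t)) (applyW-++ (ascent a s) _ Θ)

  ascent-cong : ∀ {a b} t → colour a ≡ colour b → ascent a t ≡ ascent b t
  ascent-cong zero    e = refl
  ascent-cong {a} {b} (suc t) e = cong₂ _∷_ e (ascent-cong t (trans (sym (nextF-colour a)) (trans (cong nextF e) (nextF-colour b))))

  climb-cong : ∀ {a b} t Θ → colour a ≡ colour b → climb a t Θ ≡ climb b t Θ
  climb-cong t Θ e = cong (λ w → applyW P w Θ) (ascent-cong t e)

  tabulate-ascent : ∀ t a (f : Fin t → Fin n) → (∀ i → f i ≡ colour (a + toℕ i)) → tabulate f ≡ ascent a t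
  tabulate-ascent zero    a f f≗ = refl
  tabulate-ascent (suc t) a f f≗ = cong₂ _∷_ (trans (f≗ zero) (cong colour (+-identityʳ a)))
    (tabulate-ascent t (suc a) (f ∘ suc) (λ i → trans (f≗ (suc i)) (cong colour (+-suc a (toℕ i)))))

  petrieⁿ-climb : ∀ q Θ → petrieⁿ P q Θ ≡ climb 0 (q * n) Θ
  petrieⁿ-climb zero    Θ = refl
  petrieⁿ-climb (suc q) Θ = begin
    petrie P (petrieⁿ P q Θ)            ≡⟨ cong (λ w → applyW P w (petrieⁿ P q Θ)) (tabulate-ascent n 0 id (λ i → sym (colour-toℕ i))) ⟩
    climb 0 n (petrieⁿ P q Θ)           ≡⟨ cong (climb 0 n) (petrieⁿ-climb q Θ) ⟩
    climb 0 n (climb 0 (q * n) Θ)       ≡⟨ climb-cong n _ (colour-+* 0 q) ⟨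
    climb (q * n) n (climb 0 (q * n) Θ) ≡⟨ climb-+ 0 (q * n) n Θ ⟨
    climb 0 (q * n + n) Θ               ≡⟨ cong (λ t → climb 0 t Θ) (+-comm (q * n) n) ⟩
    climb 0 (suc q * n) Θ               ∎
    where open ≡-Reasoning

  ascent-above : ∀ {lo} a t → lo ≤ a → a + t ≤ n → All (λ d → lo ≤ toℕ d) (ascent a t)
  ascent-above a zero    lo≤a a+t≤n = []
  ascent-above a (suc t) lo≤a a+t≤n =
    subst (_ ≤_) (sym (toℕ-colour-< (≤-trans (s≤s (m≤m+n a t)) (subst (_≤ n) (+-suc a t) a+t≤n)))) lo≤a
    ∷ ascent-above (suc a) t (m≤n⇒m≤1+n lo≤a) (subst (_≤ n) (+-suc a t) a+t≤n)

  climb-not-closed : ∀ a t Θ → a + suc t ≤ n → climb a (suc t) Θ ≢ Θ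
  climb-not-closed a t Θ bound closed =
    r-unreachable-above (colour a) Θ (ascent (suc a) t , above , closed)
    where
      above : All (λ d → toℕ (colour a) < toℕ d) (ascent (suc a) t)
      above = subst (λ c → All (λ d → suc c ≤ toℕ d) (ascent (suc a) t)) (sym (toℕ-colour-< (<-≤-trans (m<m+n a (s≤s z≤n)) bound)))
                (ascent-above (suc a) t ≤-refl (subst (_≤ n) (+-suc a t) bound))

  module AlongPetrie (Φ : Flag P) where

    flagAt : ℕ → Flag P
    flagAt j = climb 0 j Φ

    flagAt-+ : ∀ a t → flagAt (a + t) ≡ climb a t (flagAt a)
    flagAt-+ a t = climb-+ 0 a t Φ

    flagAt-sameVertex : ∀ q s → 1 ≤ s → s ≤ n → SameFace P zero (flagAt (q * n + s)) (petrieⁿ P (suc q) Φ)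
    flagAt-sameVertex q s 1≤s s≤n = ascent (q * n + s) (n ∸ s) , nonzero , reach
      where
        nonzero : All (_≢ zero) (ascent (q * n + s) (n ∸ s))
        nonzero = subst (All (_≢ zero)) (ascent-cong (n ∸ s) (sym (colour-*+ q s)))
                    (All.map (λ { {suc _} _ () }) (ascent-above s (n ∸ s) 1≤s (≤-reflexive (m+[n∸m]≡n s≤n))))
        reach : climb (q * n + s) (n ∸ s) (flagAt (q * n + s)) ≡ petrieⁿ P (suc q) Φ
        reach = begin
          climb (q * n + s) (n ∸ s) (flagAt (q * n + s)) ≡⟨ flagAt-+ (q * n + s) (n ∸ s) ⟨
          flagAt (q * n + s + (n ∸ s))                   ≡⟨ cong flagAt (complete-period q s≤n) ⟩
          flagAt (suc q * n)                             ≡⟨ petrieⁿ-climb (suc q) Φ ⟨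
          petrieⁿ P (suc q) Φ                            ∎
          where open ≡-Reasoning

    flagAt-sameVertex-petrieⁿ : ∀ q₁ s₁ q₂ s₂ → 1 ≤ s₁ → s₁ ≤ n → 1 ≤ s₂ → s₂ ≤ n → flagAt (q₁ * n + s₁) ≡ flagAt (q₂ * n + s₂) →
                                ¬ ¬ (petrieⁿ P (suc q₁) Φ ≡ petrieⁿ P (suc q₂) Φ)
    flagAt-sameVertex-petrieⁿ q₁ s₁ q₂ s₂ 1≤s₁ s₁≤n 1≤s₂ s₂≤n e distinct =
      simplePetrie zero refl Φ _ _ (suc q₁ , inj₁ refl) (suc q₂ , inj₁ refl) distinct
        (PathIn-trans (PathIn-sym (flagAt-sameVertex q₁ s₁ 1≤s₁ s₁≤n)) (subst (λ Ψ → SameFace P zero Ψ _) (sym e) (flagAt-sameVertex q₂ s₂ 1≤s₂ s₂≤n)))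

    flagAt-periodic : ∀ q a → a ≤ n → petrieⁿ P 1 Φ ≡ petrieⁿ P (suc q) Φ → flagAt (q * n + a) ≡ flagAt a
    flagAt-periodic q a a≤n period = sym (applyW-injective (ascent a (n ∸ a)) (begin
      climb a (n ∸ a) (flagAt a)                     ≡⟨ flagAt-+ a (n ∸ a) ⟨
      flagAt (a + (n ∸ a))                           ≡⟨ cong flagAt (trans (m+[n∸m]≡n a≤n) (sym (+-identityʳ n))) ⟩
      flagAt (1 * n)                                 ≡⟨ petrieⁿ-climb 1 Φ ⟨
      petrieⁿ P 1 Φ                                  ≡⟨ period ⟩
      petrieⁿ P (suc q) Φ                            ≡⟨ petrieⁿ-climb (suc q) Φ ⟩
      flagAt (suc q * n)                             ≡⟨ cong flagAt (complete-period q a≤n) ⟨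
      flagAt (q * n + a + (n ∸ a))                   ≡⟨ flagAt-+ (q * n + a) (n ∸ a) ⟩
      climb (q * n + a) (n ∸ a) (flagAt (q * n + a)) ≡⟨ climb-cong (n ∸ a) _ (colour-*+ q a) ⟩
      climb a (n ∸ a) (flagAt (q * n + a))           ∎))
      where open ≡-Reasoning

    flagAt-no-return : ∀ q {s s′} → s < s′ → s′ ≤ n → flagAt (q * n + s) ≢ flagAt (q * n + s′)
    flagAt-no-return q {s} {s′} s<s′ s′≤n e = climb-not-closed s (s′ ∸ suc s) (flagAt (q * n + s)) (subst (_≤ n) (sym length) s′≤n) (begin
      climb s (suc (s′ ∸ suc s)) (flagAt (q * n + s))           ≡⟨ climb-cong {q * n + s} {s} (suc (s′ ∸ suc s)) (flagAt (q * n + s)) (colour-*+ q s) ⟨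
      climb (q * n + s) (suc (s′ ∸ suc s)) (flagAt (q * n + s)) ≡⟨ flagAt-+ (q * n + s) _ ⟨
      flagAt (q * n + s + suc (s′ ∸ suc s))                     ≡⟨ cong flagAt (trans (+-assoc (q * n) s _) (cong (q * n +_) length)) ⟩
      flagAt (q * n + s′)                                       ≡⟨ e ⟨
      flagAt (q * n + s)                                        ∎)
      where
        open ≡-Reasoning
        length : s + suc (s′ ∸ suc s) ≡ s′
        length = trans (+-suc s _) (m+[n∸m]≡n s<s′)

    flagAt-injective-in-period : ∀ q {s₁ s₂} → s₁ ≤ n → s₂ ≤ n → flagAt (q * n + s₁) ≡ flagAt (q * n + s₂) → s₁ ≡ s₂
    flagAt-injective-in-period q {s₁} {s₂} s₁≤n s₂≤n e with <-cmp s₁ s₂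
    ... | tri< s₁<s₂ _ _ = ⊥-elim (flagAt-no-return q s₁<s₂ s₂≤n e)
    ... | tri≈ _ s₁≡s₂ _ = s₁≡s₂
    ... | tri> _ _ s₂<s₁ = ⊥-elim (flagAt-no-return q s₂<s₁ s₁≤n (sym e))

  -- Read Θ as flagAt a′ on the Petrie polygon through Φ. Closing up gives flagAt a′ ≡ flagAt (q * n + s);
  -- these flags share vertices with the Petrie flags petrieⁿ 1 Φ and petrieⁿ (suc q) Φ, which therefore
  -- coincide by simplicity, and injectivity within one period forces a′ ≡ s.
  climb-closed-period : ∀ a t Θ → climb a t Θ ≡ Θ → ¬ ¬ (n ∣ t)
  climb-closed-period a t Θ closed = ¬¬-map period (flagAt-sameVertex-petrieⁿ 0 a′ q s (s≤s z≤n) a′≤n (s≤s z≤n) s≤n same-flag)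
    where
      a′ = suc (toℕ (prevF (colour a)))
      a′≤n : a′ ≤ n
      a′≤n = toℕ<n (prevF (colour a))
      Φ = applyW P (reverse (ascent 0 a′)) Θ
      open AlongPetrie Φ
      Θ-at-a′ : flagAt a′ ≡ Θ
      Θ-at-a′ = applyW-applyW-reverse (ascent 0 a′) Θ
      B = toℕ (prevF (colour a)) + t
      q = B / n
      s = suc (B % n)
      s≤n : s ≤ n
      s≤n = m%n<n B n
      a′+t≡qn+s : a′ + t ≡ q * n + s
      a′+t≡qn+s = trans (cong suc (m≡m%n+[m/n]*n B n)) (+-comm s (q * n))
      same-flag : flagAt a′ ≡ flagAt (q * n + s)
      same-flag = begin
        flagAt a′              ≡⟨ Θ-at-a′ ⟩
        Θ                      ≡⟨ closed ⟨
        climb a t Θ            ≡⟨ climb-cong t Θ (nextF-prevF (colour a)) ⟨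
        climb a′ t Θ           ≡⟨ cong (climb a′ t) Θ-at-a′ ⟨
        climb a′ t (flagAt a′) ≡⟨ flagAt-+ a′ t ⟨
        flagAt (a′ + t)        ≡⟨ cong flagAt a′+t≡qn+s ⟩
        flagAt (q * n + s)     ∎
        where open ≡-Reasoning
      period : petrieⁿ P 1 Φ ≡ petrieⁿ P (suc q) Φ → n ∣ t
      period same = divides q (+-cancelˡ-≡ a′ t (q * n) (begin
        a′ + t     ≡⟨ a′+t≡qn+s ⟩
        q * n + s  ≡⟨ cong (q * n +_) a′≡s ⟨
        q * n + a′ ≡⟨ +-comm (q * n) a′ ⟩
        a′ + q * n ∎))
        where
          open ≡-Reasoning
          a′≡s : a′ ≡ s
          a′≡s = flagAt-injective-in-period q a′≤n s≤n (trans (flagAt-periodic q a′ a′≤n same) same-flag)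

  descent : Fin n → ℕ → List (Fin n)
  descent i zero    = []
  descent i (suc t) = i ∷ descent (prevF i) t

  reverse-descent : ∀ t i a → colour (a + t) ≡ nextF i → reverse (descent i t) ≡ ascent a t
  reverse-descent zero    i a e = refl
  reverse-descent (suc t) i a e = begin
    reverse (i ∷ descent (prevF i) t)  ≡⟨ unfold-reverse i (descent (prevF i) t) ⟩
    reverse (descent (prevF i) t) ∷ʳ i ≡⟨ cong (_∷ʳ i) (reverse-descent t (prevF i) a (trans last (sym (nextF-prevF i)))) ⟩
    ascent a t ∷ʳ i                    ≡⟨ cong (λ c → ascent a t ++ c ∷ []) last ⟨
    ascent a t ++ ascent (a + t) 1     ≡⟨ ascent-+ a t 1 ⟨
    ascent a (t + 1)                   ≡⟨ cong (ascent a) (+-comm t 1) ⟩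
    ascent a (suc t)                   ∎
    where
      open ≡-Reasoning
      last : colour (a + t) ≡ i
      last = nextF-injective (trans (nextF-colour (a + t)) (trans (cong colour (sym (+-suc a t))) e))

  descent-closed-period : ∀ i t Θ → applyW P (descent i t) Θ ≡ Θ → ¬ ¬ (n ∣ t)
  descent-closed-period i t Θ closed =
    climb-closed-period a t Θ (subst (λ w → applyW P w Θ ≡ Θ) (reverse-descent t i a ends) (reverse-closed (descent i t) Θ closed))
    where
      f = toℕ (nextF i)
      a = f + t * m
      ends : colour (a + t) ≡ nextF i
      ends = begin
        colour (f + t * m + t) ≡⟨ cong colour (trans (+-assoc f (t * m) t) (cong (f +_) (trans (+-comm (t * m) t) (sym (*-suc t m))))) ⟩
        colour (f + t * n)     ≡⟨ colour-+* f t ⟩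
        colour f               ≡⟨ colour-toℕ (nextF i) ⟩
        nextF i                ∎
        where open ≡-Reasoning

SelfDual-of-fixed-opposite : ∀ {n} (P : ColoredGraph n) → (∀ i → opposite i ≡ i) → SelfDual P
SelfDual-of-fixed-opposite P fixed = record
  { f = id ; f⁻ = id ; f-f⁻ = λ _ → refl ; f⁻-f = λ _ → refl
  ; f-r = λ i Φ → cong (λ j → r P j Φ) (sym (fixed i)) }

module Polygon (P : ColoredGraph 2) (polytopeP : IsPolytope P) (simplePetrie : SimplePetrie P) where
  open Cyclic 1
  open Walk P
  open IsPremaniplex (IsManiplex.premaniplex (IsPolytope.maniplex polytopeP))
  open Reversible involutive
  open PetrieWalks P polytopeP simplePetrie

  private
    opposite≡nextF : ∀ (i : Fin 2) → opposite i ≡ nextF i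
    opposite≡nextF zero       = refl
    opposite≡nextF (suc zero) = refl

    ≢⇒≡nextF : ∀ {i j : Fin 2} → i ≢ j → i ≡ nextF j
    ≢⇒≡nextF {zero}     {zero}     i≢j = contradiction refl i≢j
    ≢⇒≡nextF {zero}     {suc zero} i≢j = refl
    ≢⇒≡nextF {suc zero} {zero}     i≢j = refl
    ≢⇒≡nextF {suc zero} {suc zero} i≢j = contradiction refl i≢j

    descent≡ascent : ∀ (i : Fin 2) t → descent i t ≡ ascent (toℕ i) t
    descent≡ascent i zero    = refl
    descent≡ascent i (suc t) = cong₂ _∷_ (sym (colour-toℕ i)) (trans (descent≡ascent (prevF i) t) (ascent-cong t (prevF≡nextF i)))
      where
        prevF≡nextF : ∀ (i : Fin 2) → colour (toℕ (prevF i)) ≡ nextF i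
        prevF≡nextF zero       = refl
        prevF≡nextF (suc zero) = refl

    colour-2+ : ∀ a → colour (suc (suc a)) ≡ colour a
    colour-2+ a = trans (cong colour (+-comm 2 a)) (colour-+n a)

    opposite-colour : ∀ {c} a → c ≡ colour a → opposite c ≡ colour (suc a)
    opposite-colour a refl = trans (opposite≡nextF (colour a)) (nextF-colour a)

    ≢⇒colour-suc : ∀ {c} a → c ≢ colour a → c ≡ colour (suc a)
    ≢⇒colour-suc a c≢a = trans (≢⇒≡nextF c≢a) (nextF-colour a)

    r-cancel : ∀ {c} a → c ≡ colour a → ∀ Θ → r P (colour a) (r P c Θ) ≡ Θ
    r-cancel a refl = involutive _

  reverse-ascent : ∀ a t → reverse (ascent a t) ≡ ascent (suc (a + t)) t
  reverse-ascent a t = begin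
    reverse (ascent a t)                                 ≡⟨ cong reverse (reverse-descent t (colour (suc (a + t))) a (sym (trans (nextF-colour (suc (a + t))) (colour-2+ (a + t))))) ⟨
    reverse (reverse (descent (colour (suc (a + t))) t)) ≡⟨ reverse-involutive _ ⟩
    descent (colour (suc (a + t))) t                     ≡⟨ descent≡ascent _ t ⟩
    ascent (toℕ (colour (suc (a + t)))) t                ≡⟨ ascent-cong t (colour-toℕ _) ⟩
    ascent (suc (a + t)) t                               ∎
    where open ≡-Reasoning

  -- A closed alternating walk has even length (the Petrie period 2 divides it), and
  -- reversing an alternating walk of even length shifts its starting colour.
  climb-closed-shift : ∀ a L Θ → climb a L Θ ≡ Θ → climb (suc a) L Θ ≡ Θ
  climb-closed-shift a L Θ closed with decidable-stable (2 ∣? L) (climb-closed-period a L Θ closed)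
  ... | divides q refl = begin
    climb (suc a) (q * 2) Θ                 ≡⟨ climb-cong (q * 2) Θ (colour-+* (suc a) q) ⟨
    climb (suc (a + q * 2)) (q * 2) Θ       ≡⟨ cong (λ w → applyW P w Θ) (reverse-ascent a (q * 2)) ⟨
    applyW P (reverse (ascent a (q * 2))) Θ ≡⟨ reverse-closed (ascent a (q * 2)) Θ closed ⟩
    Θ                                       ∎
    where open ≡-Reasoning

  AlternatingForm : List (Fin 2) → Set
  AlternatingForm u = Σ ℕ λ a → Σ ℕ λ L →
    (∀ Θ → applyW P u Θ ≡ climb a L Θ) × (∀ Θ → applyW P (map opposite u) Θ ≡ climb (suc a) L Θ)

  alternatingForm : ∀ u → AlternatingForm u
  alternatingForm []      = 0 , 0 , (λ _ → refl) , (λ _ → refl)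
  alternatingForm (c ∷ u) with alternatingForm u
  ... | a , L , u≗ , ū≗ with c ≟ᶠ colour a | L
  ...   | yes c≡a | zero   = a , 1 ,
          (λ Θ → trans (u≗ (r P c Θ)) (cong (λ d → r P d Θ) c≡a)) ,
          (λ Θ → trans (ū≗ (r P (opposite c) Θ)) (cong (λ d → r P d Θ) (opposite-colour a c≡a)))
  ...   | yes c≡a | suc L′ = suc a , L′ ,
          (λ Θ → trans (u≗ (r P c Θ)) (cong (climb (suc a) L′) (r-cancel a c≡a Θ))) ,
          (λ Θ → trans (ū≗ (r P (opposite c) Θ)) (cong (climb (suc (suc a)) L′) (r-cancel (suc a) (opposite-colour a c≡a) Θ)))
  ...   | no  c≢a | l      = suc a , suc l ,
          (λ Θ → trans (u≗ (r P c Θ)) (trans (climb-cong {a} {suc (suc a)} l _ (sym (colour-2+ a)))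
                   (cong (λ d → climb (suc (suc a)) l (r P d Θ)) (≢⇒colour-suc a c≢a)))) ,
          (λ Θ → trans (ū≗ (r P (opposite c) Θ)) (trans (climb-cong {suc a} {suc (suc (suc a))} l _ (sym (colour-2+ (suc a))))
                   (cong (λ d → climb (suc (suc (suc a))) l (r P d Θ)) (opposite-colour (suc a) (≢⇒colour-suc a c≢a)))))

  map-opposite-closed : ∀ u Φ → applyW P u Φ ≡ Φ → applyW P (map opposite u) Φ ≡ Φ
  map-opposite-closed u Φ closed with alternatingForm u
  ... | a , L , u≗ , ū≗ = trans (ū≗ Φ) (climb-closed-shift a L Φ (trans (sym (u≗ Φ)) closed))

  map-opposite-≡ : ∀ v w Φ → applyW P v Φ ≡ applyW P w Φ → applyW P (map opposite v) Φ ≡ applyW P (map opposite w) Φ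
  map-opposite-≡ v w Φ e = applyW-injective (reverse w̄) (begin
    applyW P (reverse w̄) (applyW P v̄ Φ)      ≡⟨ applyW-++ v̄ (reverse w̄) Φ ⟨
    applyW P (v̄ ++ reverse w̄) Φ              ≡⟨ cong (λ x → applyW P x Φ) (trans (map-++ opposite v (reverse w)) (cong (v̄ ++_) (reverse-map opposite w))) ⟨
    applyW P (map opposite (v ++ reverse w)) Φ ≡⟨ map-opposite-closed (v ++ reverse w) Φ closed ⟩
    Φ                                          ≡⟨ applyW-reverse-applyW w̄ Φ ⟨
    applyW P (reverse w̄) (applyW P w̄ Φ)      ∎)
    where
      open ≡-Reasoning
      v̄ = map opposite v
      w̄ = map opposite w
      closed : applyW P (v ++ reverse w) Φ ≡ Φ
      closed = trans (applyW-++ v (reverse w) Φ) (trans (cong (applyW P (reverse w)) e) (applyW-reverse-applyW w Φ))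

  -- Reading each flag as a walk from a base flag, the duality swaps the two colours of that walk.
  polygon-selfDual : SelfDual P
  polygon-selfDual = record { f = F ; f⁻ = F ; f-f⁻ = F-F ; f⁻-f = F-F ; f-r = F-r }
    where
      open ≡-Reasoning
      Φ₀ = inhabited
      walkTo : Flag P → List (Fin 2)
      walkTo Φ = proj₁ (connected Φ₀ Φ)
      walkTo-reaches : ∀ Φ → applyW P (walkTo Φ) Φ₀ ≡ Φ
      walkTo-reaches Φ = proj₂ (connected Φ₀ Φ)
      F : Flag P → Flag P
      F Φ = applyW P (map opposite (walkTo Φ)) Φ₀
      F-applyW : ∀ w → F (applyW P w Φ₀) ≡ applyW P (map opposite w) Φ₀
      F-applyW w = map-opposite-≡ (walkTo (applyW P w Φ₀)) w Φ₀ (walkTo-reaches _)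
      F-r : ∀ i Φ → F (r P i Φ) ≡ r P (opposite i) (F Φ)
      F-r i Φ = begin
        F (r P i Φ)                                         ≡⟨ cong (F ∘ r P i) (walkTo-reaches Φ) ⟨
        F (r P i (applyW P (walkTo Φ) Φ₀))                  ≡⟨ cong F (applyW-∷ʳ (walkTo Φ) i Φ₀) ⟨
        F (applyW P (walkTo Φ ∷ʳ i) Φ₀)                     ≡⟨ F-applyW (walkTo Φ ∷ʳ i) ⟩
        applyW P (map opposite (walkTo Φ ∷ʳ i)) Φ₀          ≡⟨ cong (λ w → applyW P w Φ₀) (map-++ opposite (walkTo Φ) (i ∷ [])) ⟩
        applyW P (map opposite (walkTo Φ) ∷ʳ opposite i) Φ₀ ≡⟨ applyW-∷ʳ (map opposite (walkTo Φ)) (opposite i) Φ₀ ⟩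
        r P (opposite i) (F Φ)                              ∎
      F-F : ∀ Φ → F (F Φ) ≡ Φ
      F-F Φ = begin
        F (F Φ)                                              ≡⟨ F-applyW (map opposite (walkTo Φ)) ⟩
        applyW P (map opposite (map opposite (walkTo Φ))) Φ₀ ≡⟨ cong (λ w → applyW P w Φ₀) (map-opposite-involutive (walkTo Φ)) ⟩
        applyW P (walkTo Φ) Φ₀                               ≡⟨ walkTo-reaches Φ ⟩
        Φ                                                    ∎
        where
          map-opposite-involutive : ∀ w → map opposite (map opposite w) ≡ w
          map-opposite-involutive w = trans (sym (map-∘ w)) (trans (map-cong opposite-involutive w) (map-id w))

pattern c₀ = zero
pattern c₁ = suc zero
pattern c₂ = suc (suc zero)

≤0⇒c₀ : ∀ {c : Fin 3} → toℕ c ≤ 0 → c ≡ c₀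
≤0⇒c₀ {c₀} _ = refl

2≤⇒c₂ : ∀ {c : Fin 3} → 2 ≤ toℕ c → c ≡ c₂
2≤⇒c₂ {c₁} (s≤s ())
2≤⇒c₂ {c₂} _ = refl

far-apart : ∀ {i j : Fin 3} → toℕ i + 2 ≤ toℕ j → i ≡ c₀ × j ≡ c₂
far-apart {c₀} {c₀} ()
far-apart {c₀} {c₁} (s≤s ())
far-apart {c₀} {c₂} _ = refl , refl
far-apart {c₁} {c₀} ()
far-apart {c₁} {c₁} (s≤s ())
far-apart {c₁} {c₂} (s≤s (s≤s ()))
far-apart {c₂} {c₀} ()
far-apart {c₂} {c₁} (s≤s ())
far-apart {c₂} {c₂} (s≤s (s≤s ()))

module Family1 (m′ : ℕ) where
  open Cyclic (suc m′)

  X : ColoredGraph 3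
  X = family1 n

  Label : Set
  Label = Fin n × Bool

  base : Label
  base = zero , false

  _≟ˡ_ : DecidableEquality Label
  _≟ˡ_ = ≡-dec _≟ᶠ_ _≟ᵇ_

  X-flips : ∀ c x → proj₂ (r X c x) ≡ not (proj₂ x)
  X-flips c₀ (i , b)     = refl
  X-flips c₁ (i , false) = refl
  X-flips c₁ (i , true)  = refl
  X-flips c₂ (i , b)     = refl

  X-noSemiEdges : ∀ c x → r X c x ≢ x
  X-noSemiEdges c x e = not-¬ refl (trans (sym (cong proj₂ e)) (X-flips c x))

  X-involutive : ∀ c x → r X c (r X c x) ≡ x
  X-involutive c₀ (i , b)     = cong (i ,_) (not-involutive b)
  X-involutive c₁ (i , false) = cong (_, false) (nextF-prevF i)
  X-involutive c₁ (i , true)  = cong (_, true) (prevF-nextF i)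
  X-involutive c₂ (i , b)     = cong (i ,_) (not-involutive b)

  prevF≢ : ∀ (i : Fin n) → prevF i ≢ i
  prevF≢ zero    e with () ← trans (sym toℕ-prevF-zero) (cong toℕ e)
  prevF≢ (suc j) e = 1+n≢n (sym (trans (sym (toℕ-prevF-suc j)) (cong toℕ e)))

  X-r₀≢r₁ : ∀ x → r X c₀ x ≢ r X c₁ x
  X-r₀≢r₁ (i , false) e = prevF≢ i (sym (cong proj₁ e))
  X-r₀≢r₁ (i , true)  e = prevF≢ (nextF i) (trans (prevF-nextF i) (cong proj₁ e))

  rounds : ℕ → List (Fin 3)
  rounds zero    = []
  rounds (suc t) = c₀ ∷ c₁ ∷ rounds t

  rounds-from : ∀ t a → applyW X (rounds t) (colour a , false) ≡ (colour (a + t) , false)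
  rounds-from zero    a = cong (λ b → colour b , false) (sym (+-identityʳ a))
  rounds-from (suc t) a = begin
    applyW X (rounds t) (nextF (colour a) , false) ≡⟨ cong (λ i → applyW X (rounds t) (i , false)) (nextF-colour a) ⟩
    applyW X (rounds t) (colour (suc a) , false)   ≡⟨ rounds-from t (suc a) ⟩
    (colour (suc a + t) , false)                   ≡⟨ cong (λ b → colour b , false) (sym (+-suc a t)) ⟩
    (colour (a + suc t) , false)                   ∎
    where open ≡-Reasoning

  rounds-facet : ∀ t → All (_≢ c₂) (rounds t)
  rounds-facet zero    = []
  rounds-facet (suc t) = (λ ()) ∷ (λ ()) ∷ rounds-facet t

  reach : Label → List (Fin 3)
  reach (i , false) = rounds (toℕ i)
  reach (i , true)  = rounds (toℕ i) ∷ʳ c₀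

  reach-facet : ∀ x → All (_≢ c₂) (reach x)
  reach-facet (i , false) = rounds-facet (toℕ i)
  reach-facet (i , true)  = ++⁺ (rounds-facet (toℕ i)) ((λ ()) ∷ [])

  reach-reaches : ∀ x → applyW X (reach x) base ≡ x
  reach-reaches (i , false) = trans (rounds-from (toℕ i) 0) (cong (_, false) (colour-toℕ i))
  reach-reaches (i , true)  = trans (Walk.applyW-∷ʳ X (rounds (toℕ i)) c₀ base)
                                     (cong (r X c₀) (reach-reaches (i , false)))

  open Walk X
  open Reversible X-involutive

  reach-back : ∀ x → applyW X (reverse (reach x)) x ≡ base
  reach-back x = trans (cong (applyW X (reverse (reach x))) (sym (reach-reaches x))) (applyW-reverse-applyW (reach x) base)

  facetWalk : ∀ x y → Σ (List (Fin 3)) λ w → All (_≢ c₂) w × applyW X w x ≡ y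
  facetWalk x y = reverse (reach x) ++ reach y , ++⁺ (All-reverse (reach-facet x)) (reach-facet y) , (begin
    applyW X (reverse (reach x) ++ reach y) x           ≡⟨ applyW-++ (reverse (reach x)) (reach y) x ⟩
    applyW X (reach y) (applyW X (reverse (reach x)) x) ≡⟨ cong (applyW X (reach y)) (reach-back x) ⟩
    applyW X (reach y) base                             ≡⟨ reach-reaches y ⟩
    y                                                   ∎)
    where open ≡-Reasoning

  -- In X the edges of colours 0 and 2 coincide.
  vertexWalk : ∀ x y → Σ (List (Fin 3)) λ w → All (_≢ c₀) w × applyW X w x ≡ y
  vertexWalk x y with facetWalk x y
  ... | w , w≢c₂ , reaches = map c₀↦c₂ w , map⁺ (avoids w≢c₂) , trans (same-walk w x) reaches
    where
      c₀↦c₂ : Fin 3 → Fin 3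
      c₀↦c₂ c₀ = c₂
      c₀↦c₂ c  = c
      avoids : ∀ {w} → All (_≢ c₂) w → All (λ c → c₀↦c₂ c ≢ c₀) w
      avoids []                = []
      avoids {c₀ ∷ _} (_ ∷ ps) = (λ ()) ∷ avoids ps
      avoids {c₁ ∷ _} (_ ∷ ps) = (λ ()) ∷ avoids ps
      avoids {c₂ ∷ _} (p ∷ ps) = contradiction refl p ∷ avoids ps
      same-walk : ∀ w x → applyW X (map c₀↦c₂ w) x ≡ applyW X w x
      same-walk []       x = refl
      same-walk (c₀ ∷ w) x = same-walk w _
      same-walk (c₁ ∷ w) x = same-walk w _
      same-walk (c₂ ∷ w) x = same-walk w _

  σ : Label → Label
  σ (i , b) = opposite i , not b

  σ-involutive : ∀ x → σ (σ x) ≡ x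
  σ-involutive (i , b) = cong₂ _,_ (opposite-involutive i) (not-involutive b)

  σ-r : ∀ c x → r X c (σ x) ≡ σ (r X c x)
  σ-r c₀ (i , b)     = refl
  σ-r c₁ (i , false) = cong (_, false) (nextF-opposite i)
  σ-r c₁ (i , true)  = cong (_, true) (prevF-opposite i)
  σ-r c₂ (i , b)     = refl

module Derived {k : ℕ} (P : ColoredGraph (suc (suc (suc k)))) (polytopeP : IsPolytope P)
               (Γ : AutGroup P) (Φ₀ : Flag P) (ρ : Fin (suc (suc (suc k))) → AutGroup.G Γ)
               (ρ-acts : ∀ i → AutGroup.act Γ Φ₀ (ρ i) ≡ r P i Φ₀) where
  m : ℕ
  m = suc (suc k)

  open Cyclic m
  open Family1 (suc k)
  open AutGroup Γ
  open AutGroupFacts Γ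
  open IsPolytope polytopeP using (maniplex)
  open IsManiplex maniplex using (premaniplex) renaming (noSemiEdges to P-noSemiEdges)
  open IsPremaniplex premaniplex using () renaming (involutive to P-involutive; connected to P-connected; commuting to P-commuting)
  module Γ = IsGroup isGroup

  D : ColoredGraph 3
  D = derived X _∙_ (voltage1 ε ρ)

  module WX = Walk X
  module WD = Walk D

  ψ : G → Flag P
  ψ = act Φ₀

  ψ-injective : ∀ {g h} → ψ g ≡ ψ h → g ≡ h
  ψ-injective = act-injective P-connected Φ₀

  ψ-ε∙ : ∀ g → ψ (ε ∙ g) ≡ ψ g
  ψ-ε∙ g = trans (act-∙ Φ₀ ε g) (cong (λ Θ → act Θ g) (act-ε Φ₀))

  ψ-ρ∙ : ∀ i g → ψ (ρ i ∙ g) ≡ r P i (ψ g)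
  ψ-ρ∙ i g = trans (act-∙ Φ₀ (ρ i) g) (trans (cong (λ Θ → act Θ g) (ρ-acts i)) (act-r g i Φ₀))

  -- The voltage of a dart seen on P's flags through ψ, with ρ i acting as R i
  -- (R = r P, or r P ∘ opposite when comparing P with its dual).
  voltAct : (Fin n → Flag P → Flag P) → Fin 3 → Label → Flag P → Flag P
  voltAct R c₀ x       Θ = Θ
  voltAct R c₁ x       Θ = Θ
  voltAct R c₂ (i , _) Θ = R i Θ

  walkAct : (Fin n → Flag P → Flag P) → List (Fin 3) → Label → Flag P → Flag P
  walkAct R []      x Θ = Θ
  walkAct R (c ∷ w) x Θ = walkAct R w (r X c x) (voltAct R c x Θ)

  walkAct-++ : ∀ R v w x Θ → walkAct R (v ++ w) x Θ ≡ walkAct R w (applyW X v x) (walkAct R v x Θ)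
  walkAct-++ R []      w x Θ = refl
  walkAct-++ R (c ∷ v) w x Θ = walkAct-++ R v w (r X c x) (voltAct R c x Θ)

  walkAct-facet : ∀ R {w} → All (_≢ c₂) w → ∀ x Θ → walkAct R w x Θ ≡ Θ
  walkAct-facet R []                 x Θ = refl
  walkAct-facet R {c₀ ∷ _} (_ ∷ ps) x Θ = walkAct-facet R ps _ Θ
  walkAct-facet R {c₁ ∷ _} (_ ∷ ps) x Θ = walkAct-facet R ps _ Θ
  walkAct-facet R {c₂ ∷ _} (p ∷ ps) x Θ = contradiction refl p

  label-applyW : ∀ w Φ → proj₁ (applyW D w Φ) ≡ applyW X w (proj₁ Φ)
  label-applyW = derived-applyW-proj₁ X _∙_ (voltage1 ε ρ)

  ψ-r : ∀ c Φ → ψ (proj₂ (r D c Φ)) ≡ voltAct (r P) c (proj₁ Φ) (ψ (proj₂ Φ))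
  ψ-r c₀ (x , g)     = ψ-ε∙ g
  ψ-r c₁ (x , g)     = ψ-ε∙ g
  ψ-r c₂ ((i , _) , g) = ψ-ρ∙ i g

  ψ-applyW : ∀ w Φ → ψ (proj₂ (applyW D w Φ)) ≡ walkAct (r P) w (proj₁ Φ) (ψ (proj₂ Φ))
  ψ-applyW []      Φ = refl
  ψ-applyW (c ∷ w) Φ = trans (ψ-applyW w (r D c Φ)) (cong (walkAct (r P) w (r X c (proj₁ Φ))) (ψ-r c Φ))

  D-≡ : ∀ {Φ Ψ : Flag D} → proj₁ Φ ≡ proj₁ Ψ → ψ (proj₂ Φ) ≡ ψ (proj₂ Ψ) → Φ ≡ Ψ
  D-≡ e₁ e₂ = cong₂ _,_ e₁ (ψ-injective e₂)

  applyW-D : ∀ w Φ Ψ → applyW X w (proj₁ Φ) ≡ proj₁ Ψ → walkAct (r P) w (proj₁ Φ) (ψ (proj₂ Φ)) ≡ ψ (proj₂ Ψ) →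
             applyW D w Φ ≡ Ψ
  applyW-D w Φ Ψ e₁ e₂ = D-≡ (trans (label-applyW w Φ) e₁) (trans (ψ-applyW w Φ) e₂)

  facet-walk-group : ∀ {w} → All (_≢ c₂) w → ∀ Φ → proj₂ (applyW D w Φ) ≡ proj₂ Φ
  facet-walk-group {w} w≢c₂ Φ = ψ-injective (trans (ψ-applyW w Φ) (walkAct-facet (r P) w≢c₂ (proj₁ Φ) _))

  -- Walk to the 1-face e_c, cross its colour-2 edge (voltage ρ c), and come back.
  lift : Fin n → List (Fin 3)
  lift c = reach (c , false) ++ c₂ ∷ c₀ ∷ reverse (reach (c , false))

  lift-returns : ∀ c → applyW X (lift c) base ≡ base
  lift-returns c = trans (WX.applyW-++ (reach (c , false)) _ base)
    (trans (cong (applyW X (c₂ ∷ c₀ ∷ reverse (reach (c , false)))) (reach-reaches (c , false))) (reach-back (c , false)))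

  walkAct-lift : ∀ R c Θ → walkAct R (lift c) base Θ ≡ R c Θ
  walkAct-lift R c Θ = begin
    walkAct R (lift c) base Θ
      ≡⟨ walkAct-++ R (reach (c , false)) _ base Θ ⟩
    walkAct R (c₂ ∷ c₀ ∷ reverse (reach (c , false))) (applyW X (reach (c , false)) base) (walkAct R (reach (c , false)) base Θ)
      ≡⟨ cong₂ (walkAct R (c₂ ∷ c₀ ∷ reverse (reach (c , false)))) (reach-reaches (c , false)) (walkAct-facet R (reach-facet (c , false)) base Θ) ⟩
    walkAct R (reverse (reach (c , false))) (c , false) (R c Θ)
      ≡⟨ walkAct-facet R (All-reverse (reach-facet (c , false))) (c , false) (R c Θ) ⟩
    R c Θ ∎
    where open ≡-Reasoning

  liftW : List (Fin n) → List (Fin 3)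
  liftW []      = []
  liftW (c ∷ w) = lift c ++ liftW w

  liftW-returns : ∀ w → applyW X (liftW w) base ≡ base
  liftW-returns []      = refl
  liftW-returns (c ∷ w) = trans (WX.applyW-++ (lift c) (liftW w) base) (trans (cong (applyW X (liftW w)) (lift-returns c)) (liftW-returns w))

  walkAct-liftW : ∀ w Θ → walkAct (r P) (liftW w) base Θ ≡ applyW P w Θ
  walkAct-liftW []      Θ = refl
  walkAct-liftW (c ∷ w) Θ = trans (walkAct-++ (r P) (lift c) (liftW w) base Θ)
    (trans (cong₂ (walkAct (r P) (liftW w)) (lift-returns c) (walkAct-lift (r P) c Θ)) (walkAct-liftW w (r P c Θ)))

  D-connected : Connected D
  D-connected (x , g) (y , h) = w , applyW-D w (x , g) (y , h) label-path act-path
    where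
      open ≡-Reasoning
      wP = proj₁ (P-connected (ψ g) (ψ h))
      w = reverse (reach x) ++ liftW wP ++ reach y
      label-path : applyW X w x ≡ y
      label-path = begin
        applyW X w x                                                    ≡⟨ WX.applyW-++ (reverse (reach x)) _ x ⟩
        applyW X (liftW wP ++ reach y) (applyW X (reverse (reach x)) x) ≡⟨ cong (applyW X (liftW wP ++ reach y)) (reach-back x) ⟩
        applyW X (liftW wP ++ reach y) base                             ≡⟨ WX.applyW-++ (liftW wP) (reach y) base ⟩
        applyW X (reach y) (applyW X (liftW wP) base)                   ≡⟨ cong (applyW X (reach y)) (liftW-returns wP) ⟩
        applyW X (reach y) base                                         ≡⟨ reach-reaches y ⟩
        y                                                               ∎
      act-path : walkAct (r P) w x (ψ g) ≡ ψ h
      act-path = begin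
        walkAct (r P) w x (ψ g)
          ≡⟨ walkAct-++ (r P) (reverse (reach x)) _ x (ψ g) ⟩
        walkAct (r P) (liftW wP ++ reach y) (applyW X (reverse (reach x)) x) (walkAct (r P) (reverse (reach x)) x (ψ g))
          ≡⟨ cong₂ (walkAct (r P) (liftW wP ++ reach y)) (reach-back x) (walkAct-facet (r P) (All-reverse (reach-facet x)) x (ψ g)) ⟩
        walkAct (r P) (liftW wP ++ reach y) base (ψ g)
          ≡⟨ walkAct-++ (r P) (liftW wP) (reach y) base (ψ g) ⟩
        walkAct (r P) (reach y) (applyW X (liftW wP) base) (walkAct (r P) (liftW wP) base (ψ g))
          ≡⟨ cong₂ (walkAct (r P) (reach y)) (liftW-returns wP) (walkAct-liftW wP (ψ g)) ⟩
        walkAct (r P) (reach y) base (applyW P wP (ψ g))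
          ≡⟨ walkAct-facet (r P) (reach-facet y) base _ ⟩
        applyW P wP (ψ g)
          ≡⟨ proj₂ (P-connected (ψ g) (ψ h)) ⟩
        ψ h ∎

  D-involutive : ∀ c Φ → r D c (r D c Φ) ≡ Φ
  D-involutive c (x , g) = D-≡ (X-involutive c x)
    (trans (ψ-r c (r D c (x , g))) (trans (cong (voltAct (r P) c (r X c x)) (ψ-r c (x , g))) (voltAct-involutive c x (ψ g))))
    where
      voltAct-involutive : ∀ c x Θ → voltAct (r P) c (r X c x) (voltAct (r P) c x Θ) ≡ Θ
      voltAct-involutive c₀ x       Θ = refl
      voltAct-involutive c₁ x       Θ = refl
      voltAct-involutive c₂ (i , b) Θ = P-involutive i Θ

  D-r₀r₂ : ∀ Φ → r D c₀ (r D c₂ Φ) ≡ r D c₂ (r D c₀ Φ)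
  D-r₀r₂ ((i , b) , g) = cong ((i , not (not b)) ,_) (trans (Γ.identityˡ _) (cong (ρ i ∙_) (sym (Γ.identityˡ g))))

  D-commuting : ∀ (i j : Fin 3) → (toℕ i + 2 ≤ toℕ j ⊎ toℕ j + 2 ≤ toℕ i) → ∀ Φ → r D i (r D j (r D i (r D j Φ))) ≡ Φ
  D-commuting i j (inj₁ far) with far-apart far
  ... | refl , refl = WD.Reversible.commuting-square D-involutive c₀ c₂ D-r₀r₂
  D-commuting i j (inj₂ far) with far-apart far
  ... | refl , refl = WD.Reversible.commuting-square D-involutive c₂ c₀ (sym ∘ D-r₀r₂)

  D-premaniplex : IsPremaniplex D
  D-premaniplex = record { inhabited = base , ε ; involutive = D-involutive ; connected = D-connected ; commuting = D-commuting }

  D-noSemiEdges : ∀ c Φ → r D c Φ ≢ Φ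
  D-noSemiEdges c Φ e = X-noSemiEdges c (proj₁ Φ) (cong proj₁ e)

  D-r₀≢r₂ : ∀ Φ → r D c₀ Φ ≢ r D c₂ Φ
  D-r₀≢r₂ ((i , b) , g) e = P-noSemiEdges i (ψ g) (sym (trans (sym (ψ-ε∙ g)) (trans (cong (ψ ∘ proj₂) e) (ψ-ρ∙ i g))))

  D-r₂-moves-group : ∀ Φ → proj₂ (r D c₂ Φ) ≢ proj₂ Φ
  D-r₂-moves-group ((i , b) , g) e = P-noSemiEdges i (ψ g) (trans (sym (ψ-ρ∙ i g)) (cong ψ e))

  D-noParallel : ∀ i j Φ → r D i Φ ≡ r D j Φ → i ≡ j
  D-noParallel c₀ c₀ Φ e = refl
  D-noParallel c₀ c₁ Φ e = contradiction (cong proj₁ e) (X-r₀≢r₁ (proj₁ Φ))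
  D-noParallel c₀ c₂ Φ e = contradiction e (D-r₀≢r₂ Φ)
  D-noParallel c₁ c₀ Φ e = contradiction (sym (cong proj₁ e)) (X-r₀≢r₁ (proj₁ Φ))
  D-noParallel c₁ c₁ Φ e = refl
  D-noParallel c₁ c₂ Φ e = contradiction (sym (cong proj₁ e)) (X-r₀≢r₁ (proj₁ Φ))
  D-noParallel c₂ c₀ Φ e = contradiction (sym e) (D-r₀≢r₂ Φ)
  D-noParallel c₂ c₁ Φ e = contradiction (cong proj₁ e) (X-r₀≢r₁ (proj₁ Φ))
  D-noParallel c₂ c₂ Φ e = refl

  D-maniplex : IsManiplex D
  D-maniplex = record { premaniplex = D-premaniplex ; noSemiEdges = D-noSemiEdges ; noParallel = D-noParallel }

  module Polyhedron (simplePetrie : SimplePetrie P) where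
    open PetrieWalks P polytopeP simplePetrie

    spin : ℕ → List (Fin 3)
    spin zero    = []
    spin (suc t) = c₂ ∷ c₁ ∷ spin t

    spin-suc : ∀ t → spin (suc t) ≡ spin t ++ spin 1
    spin-suc zero    = refl
    spin-suc (suc t) = cong (λ w → c₂ ∷ c₁ ∷ w) (spin-suc t)

    spin-label-false : ∀ t a → applyW X (spin t) (colour a , false) ≡ (colour (a + t) , false)
    spin-label-false zero    a = cong (λ b → colour b , false) (sym (+-identityʳ a))
    spin-label-false (suc t) a = begin
      applyW X (spin t) (nextF (colour a) , false) ≡⟨ cong (λ i → applyW X (spin t) (i , false)) (nextF-colour a) ⟩
      applyW X (spin t) (colour (suc a) , false)   ≡⟨ spin-label-false t (suc a) ⟩
      (colour (suc a + t) , false)                 ≡⟨ cong (λ b → colour b , false) (sym (+-suc a t)) ⟩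
      (colour (a + suc t) , false)                 ∎
      where open ≡-Reasoning

    spin-label-true : ∀ t a → applyW X (spin t) (colour a , true) ≡ (colour (a + t * m) , true)
    spin-label-true zero    a = cong (λ b → colour b , true) (sym (+-identityʳ a))
    spin-label-true (suc t) a = begin
      applyW X (spin t) (prevF (colour a) , true) ≡⟨ cong (λ i → applyW X (spin t) (i , true)) (colour-+-modˡ a m) ⟩
      applyW X (spin t) (colour (a + m) , true)   ≡⟨ spin-label-true t (a + m) ⟩
      (colour (a + m + t * m) , true)             ≡⟨ cong (λ b → colour b , true) (+-assoc a m (t * m)) ⟩
      (colour (a + suc t * m) , true)             ∎
      where open ≡-Reasoning

    walkAct-spin-false : ∀ t i Θ → walkAct (r P) (spin t) (i , false) Θ ≡ climb (toℕ i) t Θ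
    walkAct-spin-false zero    i Θ = refl
    walkAct-spin-false (suc t) i Θ = begin
      walkAct (r P) (spin t) (nextF i , false) (r P i Θ) ≡⟨ walkAct-spin-false t (nextF i) (r P i Θ) ⟩
      climb (toℕ (nextF i)) t (r P i Θ)                  ≡⟨ climb-cong t _ (colour-toℕ (nextF i)) ⟩
      climb (suc (toℕ i)) t (r P i Θ)                    ≡⟨ cong (λ c → climb (suc (toℕ i)) t (r P c Θ)) (colour-toℕ i) ⟨
      climb (toℕ i) (suc t) Θ                            ∎
      where open ≡-Reasoning

    walkAct-spin-true : ∀ t i Θ → walkAct (r P) (spin t) (i , true) Θ ≡ applyW P (descent i t) Θ
    walkAct-spin-true zero    i Θ = refl
    walkAct-spin-true (suc t) i Θ = walkAct-spin-true t (prevF i) (r P i Θ)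

    spin-returns-false : ∀ {t} i → n ∣ t → applyW X (spin t) (i , false) ≡ (i , false)
    spin-returns-false i (divides q refl) = begin
      applyW X (spin (q * n)) (i , false)              ≡⟨ cong (λ j → applyW X (spin (q * n)) (j , false)) (colour-toℕ i) ⟨
      applyW X (spin (q * n)) (colour (toℕ i) , false) ≡⟨ spin-label-false (q * n) (toℕ i) ⟩
      (colour (toℕ i + q * n) , false)                 ≡⟨ cong (_, false) (trans (colour-+* (toℕ i) q) (colour-toℕ i)) ⟩
      (i , false)                                      ∎
      where open ≡-Reasoning

    spin-returns-true : ∀ {t} i → n ∣ t → applyW X (spin t) (i , true) ≡ (i , true)
    spin-returns-true i (divides q refl) = begin
      applyW X (spin (q * n)) (i , true)              ≡⟨ cong (λ j → applyW X (spin (q * n)) (j , true)) (colour-toℕ i) ⟨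
      applyW X (spin (q * n)) (colour (toℕ i) , true) ≡⟨ spin-label-true (q * n) (toℕ i) ⟩
      (colour (toℕ i + q * n * m) , true)             ≡⟨ cong (λ b → colour (toℕ i + b) , true) (xy∙z≈xz∙y q n m) ⟩
      (colour (toℕ i + q * m * n) , true)             ≡⟨ cong (_, true) (trans (colour-+* (toℕ i) (q * m)) (colour-toℕ i)) ⟩
      (i , true)                                      ∎
      where open ≡-Reasoning

    spin-closed-label : ∀ t Φ → proj₂ (applyW D (spin t) Φ) ≡ proj₂ Φ → ¬ ¬ (proj₁ (applyW D (spin t) Φ) ≡ proj₁ Φ)
    spin-closed-label t Φ@((i , false) , h) closed =
      ¬¬-map (trans (label-applyW (spin t) Φ) ∘ spin-returns-false i)
        (climb-closed-period (toℕ i) t (ψ h) (trans (sym (walkAct-spin-false t i (ψ h))) (trans (sym (ψ-applyW (spin t) Φ)) (cong ψ closed))))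
    spin-closed-label t Φ@((i , true) , h) closed =
      ¬¬-map (trans (label-applyW (spin t) Φ) ∘ spin-returns-true i)
        (descent-closed-period i t (ψ h) (trans (sym (walkAct-spin-true t i (ψ h))) (trans (sym (ψ-applyW (spin t) Φ)) (cong ψ closed))))

    -- The shapes of the flags reachable from Φ with colours 1 and 2 (see InVertex-path).
    data InVertex (Φ Ψ : Flag D) : Set where
      forward   : ∀ t → Ψ ≡ applyW D (spin t) Φ → InVertex Φ Ψ
      forward₁  : ∀ t → Ψ ≡ r D c₁ (applyW D (spin t) Φ) → InVertex Φ Ψ
      backward  : ∀ t → Φ ≡ applyW D (spin t) Ψ → InVertex Φ Ψ
      backward₁ : ∀ t → Φ ≡ applyW D (spin t) (r D c₁ Ψ) → InVertex Φ Ψ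

    applyW-spin-suc : ∀ t Φ → applyW D (spin (suc t)) Φ ≡ r D c₁ (r D c₂ (applyW D (spin t) Φ))
    applyW-spin-suc t Φ = trans (cong (λ w → applyW D w Φ) (spin-suc t)) (WD.applyW-++ (spin t) (spin 1) Φ)

    InVertex-r₁ : ∀ {Φ Ψ} → InVertex Φ Ψ → InVertex Φ (r D c₁ Ψ)
    InVertex-r₁ (forward t e)   = forward₁ t (cong (r D c₁) e)
    InVertex-r₁ (forward₁ t e)  = forward t (trans (cong (r D c₁) e) (D-involutive c₁ _))
    InVertex-r₁ (backward t e)  = backward₁ t (trans e (cong (applyW D (spin t)) (sym (D-involutive c₁ _))))
    InVertex-r₁ (backward₁ t e) = backward t e

    InVertex-r₂ : ∀ {Φ Ψ} → InVertex Φ Ψ → InVertex Φ (r D c₂ Ψ)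
    InVertex-r₂ {Φ} (forward t refl) = forward₁ (suc t)
      (trans (sym (D-involutive c₁ _)) (cong (r D c₁) (sym (applyW-spin-suc t Φ))))
    InVertex-r₂ {Φ} (forward₁ zero refl) = backward 1
      (sym (trans (cong (r D c₁) (D-involutive c₂ _)) (D-involutive c₁ Φ)))
    InVertex-r₂ {Φ} (forward₁ (suc t) refl) = forward t
      (trans (cong (r D c₂ ∘ r D c₁) (applyW-spin-suc t Φ)) (trans (cong (r D c₂) (D-involutive c₁ _)) (D-involutive c₂ _)))
    InVertex-r₂ {Ψ = Ψ} (backward zero refl) = forward₁ 1 (sym (D-involutive c₁ _))
    InVertex-r₂ (backward (suc t) e) = backward₁ t e
    InVertex-r₂ {Ψ = Ψ} (backward₁ t e) = backward (suc t) (trans e (cong (applyW D (spin t) ∘ r D c₁) (sym (D-involutive c₂ Ψ))))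

    InVertex-path : ∀ {Φ Ψ} → PathIn D (λ c → 1 ≤ toℕ c) Φ Ψ → InVertex Φ Ψ
    InVertex-path {Φ} (w , w≥1 , refl) = go w w≥1 (forward 0 refl)
      where
        go : ∀ w {Ψ} → All (λ c → 1 ≤ toℕ c) w → InVertex Φ Ψ → InVertex Φ (applyW D w Ψ)
        go []       []       v = v
        go (c₁ ∷ w) (_ ∷ ps) v = go w ps (InVertex-r₁ v)
        go (c₂ ∷ w) (_ ∷ ps) v = go w ps (InVertex-r₂ v)

    InVertex-sameGroup : ∀ {Φ Ψ} → InVertex Φ Ψ → proj₂ Ψ ≡ proj₂ Φ →
                         ¬ ¬ (proj₁ Ψ ≡ proj₁ Φ ⊎ proj₁ Ψ ≡ r X c₁ (proj₁ Φ))
    InVertex-sameGroup {Φ} (forward t refl) e = ¬¬-map inj₁ (spin-closed-label t Φ e)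
    InVertex-sameGroup {Φ} (forward₁ t refl) e = ¬¬-map (inj₂ ∘ cong (r X c₁)) (spin-closed-label t Φ (trans (sym (Γ.identityˡ _)) e))
    InVertex-sameGroup {Ψ = Ψ} (backward t refl) e = ¬¬-map (inj₁ ∘ sym) (spin-closed-label t Ψ (sym e))
    InVertex-sameGroup {Ψ = Ψ} (backward₁ t refl) e = ¬¬-map (λ l → inj₂ (trans (sym (X-involutive c₁ (proj₁ Ψ))) (cong (r X c₁) (sym l))))
      (spin-closed-label t (r D c₁ Ψ) (trans (sym e) (sym (Γ.identityˡ _))))

    single-colour-path : ∀ c {Q : Fin 3 → Set} → (∀ {d} → Q d → d ≡ c) → ∀ {Φ Ψ} → PathIn D Q Φ Ψ → Ψ ≡ Φ ⊎ Ψ ≡ r D c Φ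
    single-colour-path c {Q} only (w , qs , refl) = go w _ qs
      where
        go : ∀ w Φ → All Q w → applyW D w Φ ≡ Φ ⊎ applyW D w Φ ≡ r D c Φ
        go []      Φ []       = inj₁ refl
        go (d ∷ w) Φ (q ∷ qs) with only {d} q
        ... | refl with go w (r D c Φ) qs
        ...   | inj₁ e = inj₂ e
        ...   | inj₂ e = inj₁ (trans e (D-involutive c Φ))

    below₁-sameGroup : ∀ {Φ Ψ} → PathIn D (λ c → toℕ c ≤ 1) Φ Ψ → proj₂ Ψ ≡ proj₂ Φ
    below₁-sameGroup {Φ} (w , w≤1 , refl) = facet-walk-group (All.map ≤1⇒≢c₂ w≤1) Φ
      where
        ≤1⇒≢c₂ : ∀ {c : Fin 3} → toℕ c ≤ 1 → c ≢ c₂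
        ≤1⇒≢c₂ (s≤s ()) refl

    D-polytope : PolytopeCondition D
    D-polytope c₀ m Φ Ψ below _ = WD.PathIn-map (z≤n ,_) below
    D-polytope (suc k) c₂ Φ Ψ _ above = WD.PathIn-map (λ {d} k≤d → k≤d , toℕ≤2 d) above
      where
        toℕ≤2 : ∀ (d : Fin 3) → toℕ d ≤ 2
        toℕ≤2 c₀ = z≤n
        toℕ≤2 c₁ = s≤s z≤n
        toℕ≤2 c₂ = s≤s (s≤s z≤n)
    D-polytope c₁ c₀ Φ Ψ below above with single-colour-path c₀ ≤0⇒c₀ below
    ... | inj₁ refl = [] , [] , refl
    ... | inj₂ refl = ⊥-elim (InVertex-sameGroup (InVertex-path above) (Γ.identityˡ _)
                                [ X-noSemiEdges c₀ (proj₁ Φ) , X-r₀≢r₁ (proj₁ Φ) ])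
    D-polytope c₁ c₁ Φ Ψ below above with proj₁ Ψ ≟ˡ proj₁ Φ | proj₁ Ψ ≟ˡ r X c₁ (proj₁ Φ)
    ... | yes l | _     = [] , [] , cong₂ _,_ (sym l) (sym (below₁-sameGroup below))
    ... | no _  | yes l = c₁ ∷ [] , (s≤s z≤n , s≤s z≤n) ∷ [] , cong₂ _,_ (sym l) (trans (Γ.identityˡ _) (sym (below₁-sameGroup below)))
    ... | no l₁ | no l₂ = ⊥-elim (InVertex-sameGroup (InVertex-path above) (below₁-sameGroup below) [ l₁ , l₂ ])
    D-polytope c₂ c₀ Φ Ψ below above with single-colour-path c₀ ≤0⇒c₀ below | single-colour-path c₂ 2≤⇒c₂ above
    ... | inj₁ refl | _      = [] , [] , refl
    ... | inj₂ refl | inj₁ e = ⊥-elim (D-noSemiEdges c₀ Φ e)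
    ... | inj₂ refl | inj₂ e = ⊥-elim (D-r₀≢r₂ Φ e)
    D-polytope c₂ c₁ Φ Ψ below above with single-colour-path c₂ 2≤⇒c₂ above
    ... | inj₁ refl = [] , [] , refl
    ... | inj₂ refl = ⊥-elim (D-r₂-moves-group Φ (below₁-sameGroup below))

    D-polytopeness : IsPolytope D
    D-polytopeness = record { maniplex = D-maniplex ; polytope = D-polytope }

  rightMul : G → Aut D
  rightMul d = record
    { f    = λ (x , g) → x , g ∙ d
    ; f⁻   = λ (x , g) → x , g ∙ (d ⁻¹)
    ; f-f⁻ = λ (x , g) → cong (x ,_) (cancel g (d ⁻¹) d (Γ.inverseˡ d))
    ; f⁻-f = λ (x , g) → cong (x ,_) (cancel g d (d ⁻¹) (Γ.inverseʳ d))
    ; f-r  = λ c (x , g) → cong (r X c x ,_) (Γ.assoc _ g d)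
    }
    where
      cancel : ∀ g a b → a ∙ b ≡ ε → (g ∙ a) ∙ b ≡ g
      cancel g a b ab≡ε = trans (Γ.assoc g a b) (trans (cong (g ∙_) ab≡ε) (Γ.identityʳ g))

  sameLabel⇒sameOrbit : ∀ Φ Ψ → proj₁ Φ ≡ proj₁ Ψ → Σ (Aut D) λ α → Aut.f α Φ ≡ Ψ
  sameLabel⇒sameOrbit (x , g) (y , h) x≡y = rightMul ((g ⁻¹) ∙ h) , cong₂ _,_ x≡y (begin
    g ∙ ((g ⁻¹) ∙ h) ≡⟨ Γ.assoc g (g ⁻¹) h ⟨
    (g ∙ (g ⁻¹)) ∙ h ≡⟨ cong (_∙ h) (Γ.inverseʳ g) ⟩
    ε ∙ h            ≡⟨ Γ.identityˡ h ⟩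
    h                ∎)
    where open ≡-Reasoning

  transitive-along : (Q : Fin 3 → Set) → (∀ x y → Σ (List (Fin 3)) λ w → All Q w × applyW X w x ≡ y) →
                     ∀ Φ Ψ → Σ (Aut D) λ α → PathIn D Q (Aut.f α Φ) Ψ
  transitive-along Q walkX Φ Ψ with walkX (proj₁ Ψ) (proj₁ Φ)
  ... | w , qs , reaches with sameLabel⇒sameOrbit Φ (applyW D w Ψ) (sym (trans (label-applyW w Ψ) reaches))
  ...   | α , αΦ≡ = α , subst (λ Θ → PathIn D Q Θ Ψ) (sym αΦ≡) (WD.Reversible.PathIn-sym D-involutive (w , qs , refl))

  D-vertexTransitive : VertexTransitive D
  D-vertexTransitive = transitive-along (_≢ c₀) vertexWalk

  D-facetTransitive : FacetTransitive D
  D-facetTransitive = transitive-along (_≢ c₂) facetWalk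

  walkAct-σ : ∀ R w x Θ → walkAct R w (σ x) Θ ≡ walkAct (R ∘ opposite) w x Θ
  walkAct-σ R []       x       Θ = refl
  walkAct-σ R (c₀ ∷ w) x       Θ = trans (cong (λ y → walkAct R w y Θ) (σ-r c₀ x)) (walkAct-σ R w _ Θ)
  walkAct-σ R (c₁ ∷ w) x       Θ = trans (cong (λ y → walkAct R w y Θ) (σ-r c₁ x)) (walkAct-σ R w _ Θ)
  walkAct-σ R (c₂ ∷ w) (i , b) Θ = walkAct-σ R w _ (R (opposite i) Θ)

  base-flag : Flag D
  base-flag = base , ε

  Aut-label-equivariant : ∀ (α : Aut D) (τ : Label → Label) → (∀ c x → r X c (τ x) ≡ τ (r X c x)) →
                          proj₁ (Aut.f α base-flag) ≡ τ base → ∀ Φ → proj₁ (Aut.f α Φ) ≡ τ (proj₁ Φ)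
  Aut-label-equivariant α τ τ-r = WD.connected-elim D-connected (λ Φ → proj₁ (Aut.f α Φ) ≡ τ (proj₁ Φ))
    (λ c Φ e → trans (cong proj₁ (Aut.f-r α c Φ)) (trans (cong (r X c) e) (τ-r c (proj₁ Φ))))

  -- An automorphism acting on labels as σ turns each voltage ρ i into ρ (opposite i): a duality of P.
  module σ-Duality (regular : IsRegular P) (α : Aut D) (α-σ : ∀ Φ → proj₁ (Aut.f α Φ) ≡ σ (proj₁ Φ)) where
    open Aut α
    open ≡-Reasoning

    ψ⁻¹ : Flag P → G
    ψ⁻¹ Θ = proj₁ (act-surjective regular Φ₀ Θ)

    ψ-ψ⁻¹ : ∀ Θ → ψ (ψ⁻¹ Θ) ≡ Θ
    ψ-ψ⁻¹ Θ = proj₂ (act-surjective regular Φ₀ Θ)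

    ψ⁻¹-ψ : ∀ g → ψ⁻¹ (ψ g) ≡ g
    ψ⁻¹-ψ g = ψ-injective (ψ-ψ⁻¹ (ψ g))

    F F⁻ : Flag P → Flag P
    F  Θ = ψ (proj₂ (f (base , ψ⁻¹ Θ)))
    F⁻ Θ = ψ (proj₂ (f⁻ (σ base , ψ⁻¹ Θ)))

    α⁻-σ : ∀ Φ → proj₁ (f⁻ Φ) ≡ σ (proj₁ Φ)
    α⁻-σ Φ = trans (sym (σ-involutive _)) (cong σ (trans (sym (α-σ (f⁻ Φ))) (cong proj₁ (f-f⁻ Φ))))

    F⁻-F : ∀ Θ → F⁻ (F Θ) ≡ Θ
    F⁻-F Θ = begin
      ψ (proj₂ (f⁻ (σ base , ψ⁻¹ (F Θ)))) ≡⟨ cong (ψ ∘ proj₂ ∘ f⁻) (cong₂ _,_ (sym (α-σ _)) (ψ⁻¹-ψ _)) ⟩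
      ψ (proj₂ (f⁻ (f (base , ψ⁻¹ Θ))))   ≡⟨ cong (ψ ∘ proj₂) (f⁻-f _) ⟩
      ψ (ψ⁻¹ Θ)                           ≡⟨ ψ-ψ⁻¹ Θ ⟩
      Θ                                   ∎

    F-F⁻ : ∀ Θ → F (F⁻ Θ) ≡ Θ
    F-F⁻ Θ = begin
      ψ (proj₂ (f (base , ψ⁻¹ (F⁻ Θ))))   ≡⟨ cong (ψ ∘ proj₂ ∘ f) (cong₂ _,_ (sym (trans (α⁻-σ _) (σ-involutive base))) (ψ⁻¹-ψ _)) ⟩
      ψ (proj₂ (f (f⁻ (σ base , ψ⁻¹ Θ)))) ≡⟨ cong (ψ ∘ proj₂) (f-f⁻ _) ⟩
      ψ (ψ⁻¹ Θ)                           ≡⟨ ψ-ψ⁻¹ Θ ⟩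
      Θ                                   ∎

    lift-ψ⁻¹ : ∀ i Θ → applyW D (lift i) (base , ψ⁻¹ Θ) ≡ (base , ψ⁻¹ (r P i Θ))
    lift-ψ⁻¹ i Θ = applyW-D (lift i) _ _ (lift-returns i)
      (trans (walkAct-lift (r P) i _) (trans (cong (r P i) (ψ-ψ⁻¹ Θ)) (sym (ψ-ψ⁻¹ (r P i Θ)))))

    F-r : ∀ i Θ → F (r P i Θ) ≡ r P (opposite i) (F Θ)
    F-r i Θ = begin
      ψ (proj₂ (f (base , ψ⁻¹ (r P i Θ))))                    ≡⟨ cong (ψ ∘ proj₂ ∘ f) (lift-ψ⁻¹ i Θ) ⟨
      ψ (proj₂ (f (applyW D (lift i) (base , ψ⁻¹ Θ))))        ≡⟨ cong (ψ ∘ proj₂) (WD.Aut-applyW α (lift i) _) ⟩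
      ψ (proj₂ (applyW D (lift i) (f (base , ψ⁻¹ Θ))))        ≡⟨ ψ-applyW (lift i) _ ⟩
      walkAct (r P) (lift i) (proj₁ (f (base , ψ⁻¹ Θ))) (F Θ) ≡⟨ cong (λ x → walkAct (r P) (lift i) x (F Θ)) (α-σ _) ⟩
      walkAct (r P) (lift i) (σ base) (F Θ)                   ≡⟨ walkAct-σ (r P) (lift i) base (F Θ) ⟩
      walkAct (r P ∘ opposite) (lift i) base (F Θ)            ≡⟨ walkAct-lift (r P ∘ opposite) i (F Θ) ⟩
      r P (opposite i) (F Θ)                                  ∎

    selfDual : SelfDual P
    selfDual = record { f = F ; f⁻ = F⁻ ; f-f⁻ = F-F⁻ ; f⁻-f = F⁻-F ; f-r = F-r }

  hexagon : List (Fin 3)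
  hexagon = c₁ ∷ c₂ ∷ c₀ ∷ c₁ ∷ c₂ ∷ c₀ ∷ []

  hexagon² : List (Fin 3)
  hexagon² = hexagon ++ hexagon

  X-hexagon : ∀ x → applyW X hexagon x ≡ x
  X-hexagon (i , false) = cong (_, false) (nextF-prevF i)
  X-hexagon (i , true)  = cong (_, true) (prevF-nextF i)

  X-hexagon² : ∀ x → applyW X hexagon² x ≡ x
  X-hexagon² x = trans (WX.applyW-++ hexagon hexagon x) (trans (cong (applyW X hexagon) (X-hexagon x)) (X-hexagon x))

  walkAct-hexagon² : ∀ x Θ → walkAct (r P) hexagon² x Θ ≡ walkAct (r P) hexagon x (walkAct (r P) hexagon x Θ)
  walkAct-hexagon² x Θ = trans (walkAct-++ (r P) hexagon hexagon x Θ) (cong (λ y → walkAct (r P) hexagon y (walkAct (r P) hexagon x Θ)) (X-hexagon x))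

  walkAct-hexagon²-false : ∀ i Θ → walkAct (r P) hexagon² (i , false) Θ ≡ r P i (r P (prevF i) (r P i (r P (prevF i) Θ)))
  walkAct-hexagon²-false i Θ = trans (walkAct-hexagon² (i , false) Θ) (trans (cong (walkAct (r P) hexagon (i , false)) (hexagon-false Θ)) (hexagon-false _))
    where
      hexagon-false : ∀ Θ → walkAct (r P) hexagon (i , false) Θ ≡ r P i (r P (prevF i) Θ)
      hexagon-false Θ = cong (λ j → r P j (r P (prevF i) Θ)) (nextF-prevF i)

  walkAct-hexagon²-true : ∀ i Θ → walkAct (r P) hexagon² (i , true) Θ ≡ r P i (r P (nextF i) (r P i (r P (nextF i) Θ)))
  walkAct-hexagon²-true i Θ = trans (walkAct-hexagon² (i , true) Θ) (trans (cong (walkAct (r P) hexagon (i , true)) (hexagon-true Θ)) (hexagon-true _))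
    where
      hexagon-true : ∀ Θ → walkAct (r P) hexagon (i , true) Θ ≡ r P i (r P (nextF i) Θ)
      hexagon-true Θ = cong (λ j → r P j (r P (nextF i) Θ)) (prevF-nextF i)

  -- At the base label hexagon² acts as (r₀ r_{n-1})², trivial because n ≥ 3.
  hexagon²-closed : applyW D hexagon² base-flag ≡ base-flag
  hexagon²-closed = applyW-D hexagon² base-flag base-flag (X-hexagon² base)
    (trans (walkAct-hexagon²-false zero (ψ ε)) (P-commuting zero (prevF zero) (inj₁ 2≤n-1) (ψ ε)))
    where
      2≤n-1 : 2 ≤ toℕ (prevF {n} zero)
      2≤n-1 = subst (2 ≤_) (sym toℕ-prevF-zero) (s≤s (s≤s z≤n))

  Aut-hexagon²-closed : ∀ (α : Aut D) {x} → proj₁ (Aut.f α base-flag) ≡ x →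
                        walkAct (r P) hexagon² x (ψ (proj₂ (Aut.f α base-flag))) ≡ ψ (proj₂ (Aut.f α base-flag))
  Aut-hexagon²-closed α refl = trans (sym (ψ-applyW hexagon² (Aut.f α base-flag)))
    (cong (ψ ∘ proj₂) (trans (sym (WD.Aut-applyW α hexagon² base-flag)) (cong (Aut.f α) hexagon²-closed)))

  module Rigidity (nonDegenerate : NonDegenerate P) (regular : IsRegular P) (notSelfDual : ¬ SelfDual P) where

    adjacent-square-not-closed : ∀ (i : Fin n) → suc (toℕ i) < n → ∀ Θ → r P i (r P (nextF i) (r P i (r P (nextF i) Θ))) ≢ Θ
    adjacent-square-not-closed i i+1<n Θ = subst₂ (λ a b → r P a (r P b (r P a (r P b Θ))) ≢ Θ) lower upper (nonDegenerate (toℕ i) i+1<n Θ)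
      where
        lower : fromℕ< (<⇒≤ i+1<n) ≡ i
        lower = toℕ-injective (toℕ-fromℕ< (<⇒≤ i+1<n))
        upper : fromℕ< i+1<n ≡ nextF i
        upper = toℕ-injective (trans (toℕ-fromℕ< i+1<n) (sym (toℕ-colour-< i+1<n)))

    hexagon²-not-closed-false : ∀ (j : Fin m) Θ → walkAct (r P) hexagon² (suc j , false) Θ ≢ Θ
    hexagon²-not-closed-false j Θ closed = adjacent-square-not-closed p p+1<n (r P p Θ)
      (cong (r P p) (subst (λ c → r P c (r P p (r P c (r P p Θ))) ≡ Θ) (sym (nextF-prevF (suc j)))
        (trans (sym (walkAct-hexagon²-false (suc j) Θ)) closed)))
      where
        p = prevF (suc j)
        p+1<n : suc (toℕ p) < n
        p+1<n = subst (λ a → suc a < n) (sym (toℕ-prevF-suc j)) (s≤s (toℕ<n j))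

    hexagon²-not-closed-true : ∀ (i : Fin n) → toℕ i < m → ∀ Θ → walkAct (r P) hexagon² (i , true) Θ ≢ Θ
    hexagon²-not-closed-true i i<m Θ closed = adjacent-square-not-closed i (s≤s i<m) Θ (trans (sym (walkAct-hexagon²-true i Θ)) closed)

    -- The label of α base-flag is fixed by hexagon², so by non-degeneracy it is base or σ base;
    -- the latter would make P self-dual.
    Aut-preserves-labels : ∀ (α : Aut D) Φ → proj₁ (Aut.f α Φ) ≡ proj₁ Φ
    Aut-preserves-labels α with proj₁ (Aut.f α base-flag) in eq
    ... | zero  , false = Aut-label-equivariant α id (λ _ _ → refl) eq
    ... | suc j , false = ⊥-elim (hexagon²-not-closed-false j _ (Aut-hexagon²-closed α eq))
    ... | i     , true with toℕ i ≟ m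
    ...   | yes i≡m = ⊥-elim (notSelfDual (σ-Duality.selfDual regular α (Aut-label-equivariant α σ σ-r (trans eq (cong (_, true) i≡opposite-zero)))))
      where
        i≡opposite-zero : i ≡ opposite zero
        i≡opposite-zero = toℕ-injective (trans i≡m (sym (opposite-prop {n} zero)))
    ...   | no i≢m = ⊥-elim (hexagon²-not-closed-true i (≤∧≢⇒< (≤-pred (toℕ<n i)) i≢m) _ (Aut-hexagon²-closed α eq))

    D-symmetryTypeGraph : SymTypeGraphIso D X
    D-symmetryTypeGraph = record
      { q       = proj₁
      ; q-surj  = λ x → (x , ε) , refl
      ; q-orbit = sameLabel⇒sameOrbit
      ; orbit-q = Aut-preserves-labels
      ; q-r     = λ _ _ → refl
      }

    D-trivialFacetStabilizer : TrivialFacetStabilizer D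
    D-trivialFacetStabilizer α Φ (w , w≢c₂ , αΦ≡) = WD.Aut-fixes-all D-connected α
      (cong₂ _,_ (Aut-preserves-labels α Φ) (trans (cong proj₂ (sym αΦ≡)) (facet-walk-group w≢c₂ Φ)))

theorem6p3 : (n : ℕ) (P : ColoredGraph n) →
    IsPolytope P → IsRegular P → SimplePetrie P → NonDegenerate P → ¬ SelfDual P →
    (Γ : AutGroup P) (Φ₀ : Flag P) (ρ : Fin n → AutGroup.G Γ) →
    (∀ i → AutGroup.act Γ Φ₀ (ρ i) ≡ r P i Φ₀) →
    IsPolytope (derived (family1 n) (AutGroup._∙_ Γ) (voltage1 (AutGroup.ε Γ) ρ))
    × SymTypeGraphIso (derived (family1 n) (AutGroup._∙_ Γ) (voltage1 (AutGroup.ε Γ) ρ)) (family1 n)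
    × VertexTransitive (derived (family1 n) (AutGroup._∙_ Γ) (voltage1 (AutGroup.ε Γ) ρ))
    × FacetTransitive (derived (family1 n) (AutGroup._∙_ Γ) (voltage1 (AutGroup.ε Γ) ρ))
    × TrivialFacetStabilizer (derived (family1 n) (AutGroup._∙_ Γ) (voltage1 (AutGroup.ε Γ) ρ))
theorem6p3 zero P _ _ _ _ notSelfDual _ _ _ _ =
  ⊥-elim (notSelfDual (SelfDual-of-fixed-opposite P λ ()))
theorem6p3 (suc zero) P _ _ _ _ notSelfDual _ _ _ _ =
  ⊥-elim (notSelfDual (SelfDual-of-fixed-opposite P λ { zero → refl }))
theorem6p3 (suc (suc zero)) P polytopeP _ simplePetrie _ notSelfDual _ _ _ _ =
  ⊥-elim (notSelfDual (Polygon.polygon-selfDual P polytopeP simplePetrie))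
theorem6p3 (suc (suc (suc k))) P polytopeP regular simplePetrie nonDegenerate notSelfDual Γ Φ₀ ρ ρ-acts =
  D-polytopeness , D-symmetryTypeGraph , D-vertexTransitive , D-facetTransitive , D-trivialFacetStabilizer
  where
    open Derived P polytopeP Γ Φ₀ ρ ρ-acts
    open Polyhedron simplePetrie
    open Rigidity nonDegenerate regular notSelfDual
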